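{- For every $n\ge 2$, $\left|M_{2n,\binom{2n-1}{2}}\right|=2n-1$.
   Context: Pointers: for $\pi\in S_N$ written $[\pi(1)\ \cdots\ \pi(N)]$, entry $k$ has left pointer $(k-1,k)$ and right pointer $(k,k+1)$; the pointer word $W(\pi)$ lists $L(\pi(1))R(\pi(1))\cdots L(\pi(N))R(\pi(N))$ with $(0,1)$ and $(N,N+1)$ removed. Two distinct pointers form a valid pointer context if their occurrences in $W(\pi)$ interleave ($p\ldots q\ldots p\ldots q$ or $q\ldots p\ldots q\ldots p$). Strategic pile: with $X_N=(0\ 1\ \cdots\ N)$, $Y_\pi=(\pi(N)\ \cdots\ \pi(1)\ 0)$ in cycle notation and $C_\pi=Y_\pi\circ X_N$, $\mathrm{SP}(\pi)$ is the set of numbers after $N$ and before $0$ in the cycle of $C_\pi$ containing $0$ and $N$ (empty if different cycles). $\pi\in S_{2n}$ has maximal strategic pile if $|\mathrm{SP}(\pi)|=2n-1$; then $2n$ is immediately followed by $1$, and its contraction is the element of $S_{2n-1}$ obtained by deleting the entry $2n$. $M_{2n,k}$ is the set of contractions of permutations in $S_{2n}$ with maximal strategic pile and exactly $k$ valid pointer contexts. -}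

module Defs where

open import Data.Nat using (ℕ; zero; suc; _+_; _*_; _∸_; _≡ᵇ_; _<ᵇ_; _≤_)
open import Data.Bool using (Bool; true; false; if_then_else_; _∧_; _∨_; not)
open import Data.List using (List; []; _∷_; map; upTo; filterᵇ; concatMap; length; cartesianProduct)
open import Data.Maybe using (Maybe; just; nothing; fromMaybe)
open import Data.Product using (_×_; _,_; Σ; ∃-syntax)
open import Relation.Binary.PropositionalEquality using (_≡_)
open import Data.List.Relation.Binary.Permutation.Propositional using (_↭_)

-- Permutations of S_N are represented in one-line notation [π(1) … π(N)] as lists of naturals.
-- range N = [1, 2, …, N]
range : ℕ → List ℕ
range N = map suc (upTo N)

IsPerm : ℕ → List ℕ → Set
IsPerm N π = π ↭ range N

-- Pointers.  The pointer (k-1,k) is encoded by the number k.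
-- Hence entry k has left pointer k and right pointer k+1;
-- (0,1) is encoded by 1 and (N,N+1) by N+1.

pointerWord : ℕ → List ℕ → List ℕ
pointerWord N π =
  filterᵇ (λ p → not (p ≡ᵇ 1) ∧ not (p ≡ᵇ suc N))
          (concatMap (λ k → k ∷ suc k ∷ []) π)

_==ᴸ_ : List ℕ → List ℕ → Bool
[]       ==ᴸ []       = true
(x ∷ xs) ==ᴸ (y ∷ ys) = (x ≡ᵇ y) ∧ (xs ==ᴸ ys)
_        ==ᴸ _        = false

interleaves : List ℕ → ℕ → ℕ → Bool
interleaves w p q =
  let r = filterᵇ (λ x → (x ≡ᵇ p) ∨ (x ≡ᵇ q)) w in
  (r ==ᴸ (p ∷ q ∷ p ∷ q ∷ [])) ∨ (r ==ᴸ (q ∷ p ∷ q ∷ p ∷ []))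

-- Number of valid pointer contexts of π ∈ S_N: unordered pairs {p,q} of distinct
-- pointers (the pointers occurring in W(π) are among 2,…,N) whose occurrences interleave.
validContexts : ℕ → List ℕ → ℕ
validContexts N π =
  length (filterᵇ (λ pq → let p = Data.Product.proj₁ pq ; q = Data.Product.proj₂ pq in
                          (p <ᵇ q) ∧ interleaves (pointerWord N π) p q)
                  (cartesianProduct (upTo (suc N)) (upTo (suc N))))

-- Strategic pile.
-- X_N = (0 1 … N) : i ↦ i+1 for i < N, N ↦ 0.
X : ℕ → ℕ → ℕ
X N i = if i <ᵇ N then suc i else 0

lastOr : ℕ → List ℕ → ℕ
lastOr d []       = d
lastOr d (x ∷ xs) = lastOr x xs

predIn : List ℕ → ℕ → ℕ
predIn (a ∷ b ∷ rest) x = if b ≡ᵇ x then a else predIn (b ∷ rest) x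
predIn _              x = x

-- Y_π = (π(N) … π(1) 0) : 0 ↦ π(N), π(1) ↦ 0, π(k) ↦ π(k-1)
Y : List ℕ → ℕ → ℕ
Y π x = if x ≡ᵇ 0 then lastOr 0 π else predIn (0 ∷ π) x

-- C_π = Y_π ∘ X_N  (X_N applied first)
Cπ : ℕ → List ℕ → ℕ → ℕ
Cπ N π i = Y π (X N i)

-- walk the cycle of C_π starting from x (the element after N):
-- collect elements until 0 is reached (success); if N is reached first,
-- 0 and N lie in different cycles (failure).
walk : ℕ → ℕ → List ℕ → ℕ → Maybe (List ℕ)
walk zero     N π x = nothing
walk (suc f)  N π x =
  if x ≡ᵇ 0 then just []
  else if x ≡ᵇ N then nothing
  else Data.Maybe.map (x ∷_) (walk f N π (Cπ N π x))

-- SP(π) as the list of numbers after N and before 0 in the cycle of C_π (empty if different cycles)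
SP : ℕ → List ℕ → List ℕ
SP N π = fromMaybe [] (walk (suc (suc N)) N π (Cπ N π N))

contraction : ℕ → List ℕ → List ℕ
contraction n π = filterᵇ (λ x → not (x ≡ᵇ 2 * n)) π

M : ℕ → ℕ → List ℕ → Set
M n k σ = ∃[ π ] (IsPerm (2 * n) π
                 × length (SP (2 * n) π) ≡ 2 * n ∸ 1
                 × validContexts (2 * n) π ≡ k
                 × contraction n π ≡ σ)

-- A permutation of 1 … N (N = 2n) uses the pointers 2 … N twice each in its pointer word, so it has at most
-- C(N-1, 2) valid pointer contexts, with equality exactly when every two pointers interleave.  Then between the
-- two occurrences of a pointer every other pointer occurs once, so the pointer word is a square u u.  Interleaving
-- is invariant under rotating the permutation; rotating 1 to the front and reading off the square pointer word
-- shows that the permutation is a rotation of [1 3 5 … 2n-1 2 4 … 2n], and conversely all such rotations have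
-- every pointer pair interleaving.  The strategic pile of that permutation itself is empty, while for each of
-- the other 2n - 1 rotations the cycle of C through 2n and 0 consists of one or two descending runs covering
-- all of 1 … 2n-1.  Their contractions are pairwise distinct since the position of 1 determines the rotation.

module Submission where

open import Defs
open import Data.Bool using (Bool; true; false; if_then_else_; _∧_; _∨_; not; T)
open import Data.Bool.Properties using (∧-zeroʳ; ∨-zeroʳ)
open import Data.Empty using (⊥-elim)
open import Data.List using (List; []; _∷_; _++_; length; map; concatMap; filterᵇ; upTo; applyUpTo; take; drop; cartesianProduct)
open import Data.List.Properties
  using (++-conicalˡ; ++-conicalʳ; ++-identityʳ; ∷-injective; ∷-injectiveˡ; ∷-injectiveʳ; concatMap-++; filter-++;
         length-++; length-applyUpTo; length-drop; length-map; map-applyUpTo; take++drop≡id)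
open import Data.List.Membership.Propositional using (_∈_)
open import Data.List.Membership.Propositional.Properties
  using (∈-applyUpTo⁺; ∈-applyUpTo⁻; ∈-cartesianProduct⁺; ∈-cartesianProduct⁻; ∈-upTo⁺; ∈-upTo⁻)
open import Data.List.Relation.Binary.Permutation.Propositional
  using (_↭_; ↭-refl; ↭-sym; ↭-trans; prep; swap; module PermutationReasoning)
import Data.List.Relation.Binary.Permutation.Propositional as ↭
open import Data.List.Relation.Binary.Permutation.Propositional.Properties
  using (shift; ↭-length) renaming (++-comm to ↭-++-comm)
open import Data.List.Relation.Unary.All using (All; []; _∷_; lookup; tabulate)
open import Data.List.Relation.Unary.Unique.Propositional using (Unique)
open import Data.List.Relation.Unary.Unique.Propositional.Properties using (applyUpTo⁺₁)
open import Data.Maybe using (Maybe; just; nothing)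
open import Data.Maybe.Properties using (just-injective)
open import Data.Nat
open import Data.Nat.Combinatorics using (_C_; nC1≡n; nCk+nC[k+1]≡[n+1]C[k+1])
open import Data.Nat.ListAction using (sum)
open import Data.Nat.Properties
open import Algebra.Properties.CommutativeSemigroup +-commutativeSemigroup using (interchange)
open import Data.Product using (_×_; _,_; proj₁; proj₂; ∃-syntax)
open import Data.Sum using (_⊎_; inj₁; inj₂)
import Data.Sum as ⊎
open import Data.Unit using (tt)
open import Function using (_∘_)
open import Function.Bundles using (_⇔_; mk⇔; Equivalence)
open import Relation.Binary.Definitions using (tri<; tri≈; tri>)
open import Relation.Binary.PropositionalEquality
open import Relation.Nullary using (yes; no)
open import Relation.Nullary.Decidable using (T?)

≡ᵇ-refl : ∀ x → (x ≡ᵇ x) ≡ true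
≡ᵇ-refl zero = refl
≡ᵇ-refl (suc x) = ≡ᵇ-refl x

≡ᵇ-true⇒≡ : ∀ {x y} → (x ≡ᵇ y) ≡ true → x ≡ y
≡ᵇ-true⇒≡ {x} {y} e = ≡ᵇ⇒≡ x y (subst T (sym e) tt)

≢⇒≡ᵇ-false : ∀ {x y} → x ≢ y → (x ≡ᵇ y) ≡ false
≢⇒≡ᵇ-false {x} {y} x≢y with x ≡ᵇ y in e
... | false = refl
... | true = ⊥-elim (x≢y (≡ᵇ-true⇒≡ e))

≡ᵇ-false⇒≢ : ∀ {x y} → (x ≡ᵇ y) ≡ false → x ≢ y
≡ᵇ-false⇒≢ {x} e refl with trans (sym (≡ᵇ-refl x)) e
... | ()

count : ℕ → List ℕ → ℕ
count x [] = 0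
count x (y ∷ ys) = if y ≡ᵇ x then suc (count x ys) else count x ys

count-here : ∀ x ys → count x (x ∷ ys) ≡ suc (count x ys)
count-here x ys rewrite ≡ᵇ-refl x = refl

count-there : ∀ x y ys → y ≢ x → count x (y ∷ ys) ≡ count x ys
count-there x y ys y≢x rewrite ≢⇒≡ᵇ-false y≢x = refl

count-here-pos : ∀ x ys → 1 ≤ count x (x ∷ ys)
count-here-pos x ys = subst (1 ≤_) (sym (count-here x ys)) (s≤s z≤n)

count-∷-cancel : ∀ x y xs ys → count x (y ∷ xs) ≡ count x (y ∷ ys) → count x xs ≡ count x ys
count-∷-cancel x y xs ys e with y ≡ᵇ x
... | true = suc-injective e
... | false = e

count-++ : ∀ x xs ys → count x (xs ++ ys) ≡ count x xs + count x ys
count-++ x [] ys = refl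
count-++ x (y ∷ xs) ys with y ≡ᵇ x
... | true = cong suc (count-++ x xs ys)
... | false = count-++ x xs ys

count-++ˡ-≤ : ∀ x xs ys → count x xs ≤ count x (xs ++ ys)
count-++ˡ-≤ x xs ys = subst (count x xs ≤_) (sym (count-++ x xs ys)) (m≤m+n _ _)

count-++ʳ-≤ : ∀ x xs ys → count x ys ≤ count x (xs ++ ys)
count-++ʳ-≤ x xs ys = subst (count x ys ≤_) (sym (count-++ x xs ys)) (m≤n+m _ _)

count-↭ : ∀ x {xs ys} → xs ↭ ys → count x xs ≡ count x ys
count-↭ x ↭.refl = refl
count-↭ x (prep y p) with y ≡ᵇ x
... | true = cong suc (count-↭ x p)
... | false = count-↭ x p
count-↭ x (swap y z p) with y ≡ᵇ x | z ≡ᵇ x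
... | true | true = cong (suc ∘ suc) (count-↭ x p)
... | true | false = cong suc (count-↭ x p)
... | false | true = cong suc (count-↭ x p)
... | false | false = count-↭ x p
count-↭ x (↭.trans p q) = trans (count-↭ x p) (count-↭ x q)

first-occurrence : ∀ x xs → 1 ≤ count x xs → ∃[ A ] ∃[ B ] (xs ≡ A ++ x ∷ B × count x A ≡ 0)
first-occurrence x (y ∷ xs) pos with y ≡ᵇ x in e
... | true = [] , xs , cong (_∷ xs) (≡ᵇ-true⇒≡ e) , refl
... | false with first-occurrence x xs pos
... | A , B , refl , c = y ∷ A , B , refl , trans (count-there x y A (≡ᵇ-false⇒≢ e)) c

first-occurrence-unique : ∀ a P Q P′ Q′ → P ++ a ∷ Q ≡ P′ ++ a ∷ Q′ →
                          count a P ≡ 0 → count a P′ ≡ 0 → P ≡ P′ × Q ≡ Q′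
first-occurrence-unique a [] Q [] Q′ e _ _ = refl , ∷-injectiveʳ e
first-occurrence-unique a [] Q (x ∷ P′) Q′ e _ c′ with refl ← ∷-injectiveˡ e = ⊥-elim (0≢1+n (trans (sym c′) (count-here a P′)))
first-occurrence-unique a (x ∷ P) Q [] Q′ e c _ with refl ← ∷-injectiveˡ e = ⊥-elim (0≢1+n (trans (sym c) (count-here x P)))
first-occurrence-unique a (x ∷ P) Q (y ∷ P′) Q′ e c c′ with refl ← ∷-injectiveˡ e | x ≡ᵇ a
... | false with refl , refl ← first-occurrence-unique a P Q P′ Q′ (∷-injectiveʳ e) c c′ = refl , refl

count≡0⇒[] : ∀ xs → (∀ x → count x xs ≡ 0) → xs ≡ []
count≡0⇒[] [] _ = refl
count≡0⇒[] (y ∷ xs) none = ⊥-elim (1+n≢0 (trans (sym (count-here y xs)) (none y)))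

counts⇒↭ : ∀ xs ys → (∀ x → count x xs ≡ count x ys) → xs ↭ ys
counts⇒↭ [] ys same = subst ([] ↭_) (sym (count≡0⇒[] ys (λ x → sym (same x)))) ↭-refl
counts⇒↭ (y ∷ xs) ys same
  with A , B , refl , _ ← first-occurrence y ys (subst (1 ≤_) (same y) (count-here-pos y xs))
  = ↭-trans (prep y (counts⇒↭ xs (A ++ B) same′)) (↭-sym (shift y A B))
  where
  same′ : ∀ x → count x xs ≡ count x (A ++ B)
  same′ x = count-∷-cancel x y xs (A ++ B) (trans (same x) (count-↭ x (shift y A B)))

count-split : ∀ x A R → count x (A ++ x ∷ R) ≡ count x A + suc (count x R)
count-split x A R = trans (count-++ x A (x ∷ R)) (cong (count x A +_) (count-here x R))

count≡2⇒split : ∀ x w → count x w ≡ 2 →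
                ∃[ A ] ∃[ B ] ∃[ Z ] (w ≡ A ++ x ∷ B ++ x ∷ Z × count x A ≡ 0 × count x B ≡ 0 × count x Z ≡ 0)
count≡2⇒split x w two
  with A , R , refl , xA ← first-occurrence x w (subst (1 ≤_) (sym two) (s≤s z≤n))
  with xR≡1 ← suc-injective (trans (sym (cong (_+ suc (count x R)) xA)) (trans (sym (count-split x A R)) two))
  with B , Z , refl , xB ← first-occurrence x R (≤-reflexive (sym xR≡1))
  = A , B , Z , refl , xA , xB , suc-injective (trans (sym (cong (_+ suc (count x Z)) xB)) (trans (sym (count-split x B Z)) xR≡1))

count-once-prefix : ∀ x P Q → count x (P ++ x ∷ Q) ≡ 1 → count x P ≡ 0
count-once-prefix x P Q once =
  m+n≡0⇒m≡0 (count x P) (suc-injective (trans (sym (+-suc (count x P) (count x Q))) (trans (sym (count-split x P Q)) once)))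

count-++-exclusive : ∀ y P Q → count y (P ++ Q) ≤ 1 → 1 ≤ count y Q → count y P ≡ 0
count-++-exclusive y P Q once y∈Q =
  n≤0⇒n≡0 (+-cancelʳ-≤ 1 (count y P) 0 (≤-trans (+-monoʳ-≤ (count y P) y∈Q) (subst (_≤ 1) (count-++ y P Q) once)))

interval : ℕ → ℕ → List ℕ
interval a zero = []
interval a (suc k) = a ∷ interval (suc a) k

length-interval : ∀ a k → length (interval a k) ≡ k
length-interval a zero = refl
length-interval a (suc k) = cong suc (length-interval (suc a) k)

interval-∷ʳ : ∀ a k → interval a (suc k) ≡ interval a k ++ (a + k) ∷ []
interval-∷ʳ a zero = cong (_∷ []) (sym (+-identityʳ a))
interval-∷ʳ a (suc k) = cong (a ∷_) (trans (interval-∷ʳ (suc a) k) (cong (λ t → interval (suc a) k ++ t ∷ []) (sym (+-suc a k))))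

applyUpTo≡interval : ∀ (f : ℕ → ℕ) a n → (∀ i → f i ≡ a + i) → applyUpTo f n ≡ interval a n
applyUpTo≡interval f a zero _ = refl
applyUpTo≡interval f a (suc n) f≗a+ =
  cong₂ _∷_ (trans (f≗a+ 0) (+-identityʳ a)) (applyUpTo≡interval (f ∘ suc) (suc a) n (λ i → trans (f≗a+ (suc i)) (+-suc a i)))

upTo≡interval : ∀ n → upTo n ≡ interval 0 n
upTo≡interval n = applyUpTo≡interval (λ i → i) 0 n (λ _ → refl)

range≡interval : ∀ n → range n ≡ interval 1 n
range≡interval n = trans (map-applyUpTo (λ i → i) suc n) (applyUpTo≡interval suc 1 n (λ _ → refl))

count-interval-< : ∀ x a k → x < a → count x (interval a k) ≡ 0
count-interval-< x a zero _ = refl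
count-interval-< x a (suc k) x<a =
  trans (count-there x a (interval (suc a) k) (λ e → <-irrefl (sym e) x<a)) (count-interval-< x (suc a) k (m<n⇒m<1+n x<a))

count-interval-≥ : ∀ x a k → a + k ≤ x → count x (interval a k) ≡ 0
count-interval-≥ x a zero _ = refl
count-interval-≥ x a (suc k) a+k≤x =
  trans (count-there x a (interval (suc a) k) (λ e → <-irrefl e (<-≤-trans (m<m+n a z<s) a+k≤x)))
        (count-interval-≥ x (suc a) k (subst (_≤ x) (+-suc a k) a+k≤x))

count-interval-∈ : ∀ x a k → a ≤ x → x < a + k → count x (interval a k) ≡ 1
count-interval-∈ x a zero a≤x x<a+0 = ⊥-elim (<⇒≱ x<a+0 (subst (_≤ x) (sym (+-identityʳ a)) a≤x))
count-interval-∈ x a (suc k) a≤x x<a+sk with a ≟ x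
... | yes refl = trans (count-here a (interval (suc a) k)) (cong suc (count-interval-< a (suc a) k ≤-refl))
... | no a≢x = trans (count-there x a (interval (suc a) k) a≢x)
                     (count-interval-∈ x (suc a) k (≤∧≢⇒< a≤x a≢x) (subst (x <_) (+-suc a k) x<a+sk))

record IsRangePerm (lo hi : ℕ) (xs : List ℕ) : Set where
  field
    once  : ∀ y → lo ≤ y → y ≤ hi → count y xs ≡ 1
    below : ∀ y → y < lo → count y xs ≡ 0
    above : ∀ y → hi < y → count y xs ≡ 0

  bounds : ∀ y → 1 ≤ count y xs → lo ≤ y × y ≤ hi
  bounds y pos with lo ≤? y | y ≤? hi
  ... | yes lo≤y | yes y≤hi = lo≤y , y≤hi
  ... | no lo≰y | _ = ⊥-elim (<-irrefl (sym (below y (≰⇒> lo≰y))) pos)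
  ... | yes _ | no y≰hi = ⊥-elim (<-irrefl (sym (above y (≰⇒> y≰hi))) pos)

  at-most-once : ∀ y → count y xs ≤ 1
  at-most-once y with lo ≤? y | y ≤? hi
  ... | yes lo≤y | yes y≤hi = ≤-reflexive (once y lo≤y y≤hi)
  ... | no lo≰y | _ = ≤-trans (≤-reflexive (below y (≰⇒> lo≰y))) z≤n
  ... | yes _ | no y≰hi = ≤-trans (≤-reflexive (above y (≰⇒> y≰hi))) z≤n

open IsRangePerm public

interval-isRangePerm : ∀ a k → IsRangePerm (suc a) (a + k) (interval (suc a) k)
interval-isRangePerm a k = record
  { once = λ y sa≤y y≤a+k → count-interval-∈ y (suc a) k sa≤y (s≤s y≤a+k)
  ; below = λ y y<sa → count-interval-< y (suc a) k y<sa
  ; above = λ y a+k<y → count-interval-≥ y (suc a) k a+k<y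
  }

IsRangePerm-↭ : ∀ {lo hi xs ys} → xs ↭ ys → IsRangePerm lo hi ys → IsRangePerm lo hi xs
IsRangePerm-↭ p rp = record
  { once = λ y l h → trans (count-↭ y p) (once rp y l h)
  ; below = λ y l → trans (count-↭ y p) (below rp y l)
  ; above = λ y h → trans (count-↭ y p) (above rp y h)
  }

IsRangePerm-++-comm : ∀ {lo hi} xs ys → IsRangePerm lo hi (xs ++ ys) → IsRangePerm lo hi (ys ++ xs)
IsRangePerm-++-comm xs ys = IsRangePerm-↭ (↭-++-comm ys xs)

IsRangePerm⇒↭ : ∀ {lo hi xs ys} → IsRangePerm lo hi xs → IsRangePerm lo hi ys → xs ↭ ys
IsRangePerm⇒↭ {lo} {hi} {xs} {ys} rx ry = counts⇒↭ xs ys same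
  where
  same : ∀ y → count y xs ≡ count y ys
  same y with lo ≤? y | y ≤? hi
  ... | yes l | yes h = trans (once rx y l h) (sym (once ry y l h))
  ... | no l | _ = trans (below rx y (≰⇒> l)) (sym (below ry y (≰⇒> l)))
  ... | yes _ | no h = trans (above rx y (≰⇒> h)) (sym (above ry y (≰⇒> h)))

IsPerm⇔IsRangePerm : ∀ N π → IsPerm N π ⇔ IsRangePerm 1 N π
IsPerm⇔IsRangePerm N π = mk⇔ (λ p → IsRangePerm-↭ p range-isRangePerm) (λ rp → IsRangePerm⇒↭ rp range-isRangePerm)
  where
  range-isRangePerm : IsRangePerm 1 N (range N)
  range-isRangePerm = subst (IsRangePerm 1 N) (sym (range≡interval N)) (interval-isRangePerm 0 N)

IsRangePerm-empty : ∀ {lo hi xs} → hi < lo → IsRangePerm lo hi xs → xs ≡ []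
IsRangePerm-empty {lo} {hi} {xs} hi<lo rp = count≡0⇒[] xs none
  where
  none : ∀ y → count y xs ≡ 0
  none y with y <? lo
  ... | yes y<lo = below rp y y<lo
  ... | no y≮lo = above rp y (<-≤-trans hi<lo (≮⇒≥ y≮lo))

IsRangePerm-drop₂ : ∀ {m hi} X Y → IsRangePerm m hi (m ∷ X ++ suc m ∷ Y) → IsRangePerm (2 + m) hi (X ++ Y)
IsRangePerm-drop₂ {m} {hi} X Y rp = record { once = once′ ; below = below′ ; above = above′ }
  where
  L : List ℕ
  L = m ∷ X ++ suc m ∷ Y
  count-L : ∀ y → count y L ≡ count y (m ∷ suc m ∷ X ++ Y)
  count-L y = count-↭ y (prep m (shift (suc m) X Y))
  count-m : count m L ≡ suc (count m (X ++ Y))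
  count-m = trans (count-L m) (trans (count-here m (suc m ∷ X ++ Y)) (cong suc (count-there m (suc m) (X ++ Y) 1+n≢n)))
  count-sm : count (suc m) L ≡ suc (count (suc m) (X ++ Y))
  count-sm = trans (count-L (suc m)) (trans (count-there (suc m) m (suc m ∷ X ++ Y) (1+n≢n ∘ sym)) (count-here (suc m) (X ++ Y)))
  count-other : ∀ y → y ≢ m → y ≢ suc m → count y (X ++ Y) ≡ count y L
  count-other y y≢m y≢sm =
    sym (trans (count-L y) (trans (count-there y m (suc m ∷ X ++ Y) (y≢m ∘ sym)) (count-there y (suc m) (X ++ Y) (y≢sm ∘ sym))))
  m≤hi : m ≤ hi
  m≤hi = proj₂ (bounds rp m (subst (1 ≤_) (sym count-m) z<s))
  sm≤hi : suc m ≤ hi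
  sm≤hi = proj₂ (bounds rp (suc m) (subst (1 ≤_) (sym count-sm) z<s))
  once′ : ∀ y → 2 + m ≤ y → y ≤ hi → count y (X ++ Y) ≡ 1
  once′ y ssm≤y y≤hi = trans (count-other y (λ { refl → <-irrefl refl (<-trans (n<1+n y) ssm≤y) }) (λ { refl → <-irrefl refl ssm≤y }))
                             (once rp y (≤-trans (n≤1+n m) (<⇒≤ ssm≤y)) y≤hi)
  below′ : ∀ y → y < 2 + m → count y (X ++ Y) ≡ 0
  below′ y y<ssm with y ≟ m | y ≟ suc m
  ... | yes refl | _ = suc-injective (trans (sym count-m) (once rp y ≤-refl m≤hi))
  ... | no _ | yes refl = suc-injective (trans (sym count-sm) (once rp y (n≤1+n m) sm≤hi))
  ... | no y≢m | no y≢sm =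
    trans (count-other y y≢m y≢sm) (below rp y (≤∧≢⇒< (≤-pred (≤∧≢⇒< (≤-pred y<ssm) y≢sm)) y≢m))
  above′ : ∀ y → hi < y → count y (X ++ Y) ≡ 0
  above′ y hi<y = trans (count-other y (λ { refl → <⇒≱ hi<y m≤hi }) (λ { refl → <⇒≱ hi<y sm≤hi })) (above rp y hi<y)

-- Pointer words

filterᵇ-++ : ∀ {A : Set} (g : A → Bool) xs ys → filterᵇ g (xs ++ ys) ≡ filterᵇ g xs ++ filterᵇ g ys
filterᵇ-++ g = filter-++ (T? ∘ g)

filterᵇ-accept : ∀ {A : Set} (g : A → Bool) x xs → g x ≡ true → filterᵇ g (x ∷ xs) ≡ x ∷ filterᵇ g xs
filterᵇ-accept g x xs gx rewrite gx = refl

filterᵇ-reject : ∀ {A : Set} (g : A → Bool) x xs → g x ≡ false → filterᵇ g (x ∷ xs) ≡ filterᵇ g xs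
filterᵇ-reject g x xs gx rewrite gx = refl

count-filterᵇ-accept : ∀ (g : ℕ → Bool) x L → g x ≡ true → count x (filterᵇ g L) ≡ count x L
count-filterᵇ-accept g x [] _ = refl
count-filterᵇ-accept g x (y ∷ L) gx with y ≟ x
... | yes refl rewrite gx | count-here y (filterᵇ g L) | count-here y L = cong suc (count-filterᵇ-accept g x L gx)
... | no y≢x with g y
... | true rewrite count-there x y (filterᵇ g L) y≢x | count-there x y L y≢x = count-filterᵇ-accept g x L gx
... | false rewrite count-there x y L y≢x = count-filterᵇ-accept g x L gx

count-filterᵇ-reject : ∀ (g : ℕ → Bool) x L → g x ≡ false → count x (filterᵇ g L) ≡ 0
count-filterᵇ-reject g x [] _ = refl
count-filterᵇ-reject g x (y ∷ L) gx with y ≟ x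
... | yes refl rewrite gx = count-filterᵇ-reject g x L gx
... | no y≢x with g y
... | true rewrite count-there x y (filterᵇ g L) y≢x = count-filterᵇ-reject g x L gx
... | false = count-filterᵇ-reject g x L gx

-- pointerWord N π unfolds to filterᵇ (isInner N) (pointers π).
pointers : List ℕ → List ℕ
pointers = concatMap (λ k → k ∷ suc k ∷ [])

isInner : ℕ → ℕ → Bool
isInner N p = not (p ≡ᵇ 1) ∧ not (p ≡ᵇ suc N)

isInner-accept : ∀ N x → 2 ≤ x → x ≤ N → isInner N x ≡ true
isInner-accept N x 2≤x x≤N
  rewrite ≢⇒≡ᵇ-false {x} {1} (λ { refl → <-irrefl refl 2≤x })
        | ≢⇒≡ᵇ-false {x} {suc N} (λ { refl → <-irrefl refl x≤N }) = refl

isInner-reject-suc : ∀ N → isInner N (suc N) ≡ false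
isInner-reject-suc N rewrite ≡ᵇ-refl N = ∧-zeroʳ (not (suc N ≡ᵇ 1))

pointerWord-++ : ∀ N xs ys → pointerWord N (xs ++ ys) ≡ pointerWord N xs ++ pointerWord N ys
pointerWord-++ N xs ys rewrite concatMap-++ (λ k → k ∷ suc k ∷ []) xs ys = filterᵇ-++ (isInner N) (pointers xs) (pointers ys)

count-pointers-suc : ∀ y π → count (suc y) (pointers π) ≡ count (suc y) π + count y π
count-pointers-suc y [] = refl
count-pointers-suc y (k ∷ π) = begin
  count (suc y) ((k ∷ suc k ∷ []) ++ pointers π)
    ≡⟨ count-++ (suc y) (k ∷ suc k ∷ []) (pointers π) ⟩
  count (suc y) ((k ∷ []) ++ suc k ∷ []) + count (suc y) (pointers π)
    ≡⟨ cong₂ _+_ (count-++ (suc y) (k ∷ []) (suc k ∷ [])) (count-pointers-suc y π) ⟩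
  (count (suc y) (k ∷ []) + count y (k ∷ [])) + (count (suc y) π + count y π)
    ≡⟨ interchange (count (suc y) (k ∷ [])) _ _ _ ⟩
  (count (suc y) (k ∷ []) + count (suc y) π) + (count y (k ∷ []) + count y π)
    ≡⟨ sym (cong₂ _+_ (count-++ (suc y) (k ∷ []) π) (count-++ y (k ∷ []) π)) ⟩
  count (suc y) (k ∷ π) + count y (k ∷ π) ∎
  where open ≡-Reasoning

count-pointers-zero : ∀ π → count 0 (pointers π) ≡ count 0 π
count-pointers-zero [] = refl
count-pointers-zero (k ∷ π) with k ≡ᵇ 0
... | true = cong suc (count-pointers-zero π)
... | false = count-pointers-zero π

module _ {M : ℕ} {π : List ℕ} (rp : IsRangePerm 1 (suc M) π) where

  count-pointerWord-inner : ∀ x → 2 ≤ x → x ≤ suc M → count x (pointerWord (suc M) π) ≡ 2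
  count-pointerWord-inner (suc y) (s≤s 1≤y) x≤N = begin
    count (suc y) (pointerWord (suc M) π)
      ≡⟨ count-filterᵇ-accept (isInner (suc M)) (suc y) (pointers π) (isInner-accept (suc M) (suc y) (s≤s 1≤y) x≤N) ⟩
    count (suc y) (pointers π)
      ≡⟨ count-pointers-suc y π ⟩
    count (suc y) π + count y π
      ≡⟨ cong₂ _+_ (once rp (suc y) (s≤s z≤n) x≤N) (once rp y 1≤y (≤-trans (n≤1+n y) x≤N)) ⟩
    2 ∎
    where open ≡-Reasoning

  count-pointerWord-outer : ∀ x → x < 2 ⊎ suc M < x → count x (pointerWord (suc M) π) ≡ 0
  count-pointerWord-outer zero _ =
    trans (count-filterᵇ-accept (isInner (suc M)) 0 (pointers π) refl) (trans (count-pointers-zero π) (below rp 0 z<s))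
  count-pointerWord-outer (suc zero) _ = count-filterᵇ-reject (isInner (suc M)) 1 (pointers π) refl
  count-pointerWord-outer (suc (suc y)) (inj₁ (s≤s (s≤s ())))
  count-pointerWord-outer (suc (suc y)) (inj₂ (s≤s N<sy)) with suc y ≟ suc M
  ... | yes refl = count-filterᵇ-reject (isInner (suc M)) (suc (suc M)) (pointers π) (isInner-reject-suc (suc M))
  ... | no sy≢N = begin
    count (suc (suc y)) (pointerWord (suc M) π) ≡⟨ count-filterᵇ-accept (isInner (suc M)) (suc (suc y)) (pointers π) inner ⟩
    count (suc (suc y)) (pointers π)            ≡⟨ count-pointers-suc (suc y) π ⟩
    count (suc (suc y)) π + count (suc y) π
      ≡⟨ cong₂ _+_ (above rp (suc (suc y)) (s≤s N<sy)) (above rp (suc y) (≤∧≢⇒< N<sy (sy≢N ∘ sym))) ⟩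
    0 ∎
    where
    open ≡-Reasoning
    inner : isInner (suc M) (suc (suc y)) ≡ true
    inner rewrite ≢⇒≡ᵇ-false {suc y} {suc M} sy≢N = refl

  pointerWord-counts : ∀ x → count x (pointerWord (suc M) π) ≡ count x (interval 2 M ++ interval 2 M)
  pointerWord-counts x = trans (counts x) (sym (count-++ x (interval 2 M) (interval 2 M)))
    where
    counts : ∀ x → count x (pointerWord (suc M) π) ≡ count x (interval 2 M) + count x (interval 2 M)
    counts x with 2 ≤? x | x ≤? suc M
    ... | yes 2≤x | yes x≤N =
      trans (count-pointerWord-inner x 2≤x x≤N) (sym (cong (λ c → c + c) (count-interval-∈ x 2 M 2≤x (s≤s x≤N))))
    ... | no 2≰x | _ =
      trans (count-pointerWord-outer x (inj₁ (≰⇒> 2≰x))) (sym (cong (λ c → c + c) (count-interval-< x 2 M (≰⇒> 2≰x))))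
    ... | yes _ | no x≰N =
      trans (count-pointerWord-outer x (inj₂ (≰⇒> x≰N))) (sym (cong (λ c → c + c) (count-interval-≥ x 2 M (≰⇒> x≰N))))

  length-pointerWord : length (pointerWord (suc M) π) ≡ M + M
  length-pointerWord = begin
    length (pointerWord (suc M) π)
      ≡⟨ ↭-length (counts⇒↭ (pointerWord (suc M) π) (interval 2 M ++ interval 2 M) pointerWord-counts) ⟩
    length (interval 2 M ++ interval 2 M)     ≡⟨ length-++ (interval 2 M) ⟩
    length (interval 2 M) + length (interval 2 M) ≡⟨ cong (λ l → l + l) (length-interval 2 M) ⟩
    M + M ∎
    where open ≡-Reasoning

  pointerWord-bounds : ∀ x → 1 ≤ count x (pointerWord (suc M) π) → 2 ≤ x × x ≤ suc M
  pointerWord-bounds x pos with 2 ≤? x | x ≤? suc M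
  ... | yes 2≤x | yes x≤N = 2≤x , x≤N
  ... | no 2≰x | _ = ⊥-elim (<-irrefl (sym (count-pointerWord-outer x (inj₁ (≰⇒> 2≰x)))) pos)
  ... | yes _ | no x≰N = ⊥-elim (<-irrefl (sym (count-pointerWord-outer x (inj₂ (≰⇒> x≰N)))) pos)

module _ {N : ℕ} (2≤N : 2 ≤ N) where

  pointerWord-∷-inner : ∀ x L → 2 ≤ x → x < N → pointerWord N (x ∷ L) ≡ x ∷ suc x ∷ pointerWord N L
  pointerWord-∷-inner x L 2≤x x<N =
    trans (filterᵇ-accept (isInner N) x (suc x ∷ pointers L) (isInner-accept N x 2≤x (<⇒≤ x<N)))
          (cong (x ∷_) (filterᵇ-accept (isInner N) (suc x) (pointers L) (isInner-accept N (suc x) (m≤n⇒m≤1+n 2≤x) x<N)))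

  pointerWord-∷-last : ∀ L → pointerWord N (N ∷ L) ≡ N ∷ pointerWord N L
  pointerWord-∷-last L =
    trans (filterᵇ-accept (isInner N) N (suc N ∷ pointers L) (isInner-accept N N 2≤N ≤-refl))
          (cong (N ∷_) (filterᵇ-reject (isInner N) (suc N) (pointers L) (isInner-reject-suc N)))

  pointerWord-∷-one : ∀ L → pointerWord N (1 ∷ L) ≡ 2 ∷ pointerWord N L
  pointerWord-∷-one L = filterᵇ-accept (isInner N) 2 (pointers L) (isInner-accept N 2 ≤-refl 2≤N)

  pointerWord-∷-head : ∀ x L → 2 ≤ x → x ≤ N → ∃[ r ] pointerWord N (x ∷ L) ≡ x ∷ r
  pointerWord-∷-head x L 2≤x x≤N with x ≟ N
  ... | yes refl = pointerWord N L , pointerWord-∷-last L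
  ... | no x≢N = suc x ∷ pointerWord N L , pointerWord-∷-inner x L 2≤x (≤∧≢⇒< x≤N x≢N)

-- Interleaving pointers

==ᴸ⇒≡ : ∀ xs ys → (xs ==ᴸ ys) ≡ true → xs ≡ ys
==ᴸ⇒≡ [] [] _ = refl
==ᴸ⇒≡ (x ∷ xs) (y ∷ ys) e with x ≡ᵇ y in x≡ᵇy
... | true = cong₂ _∷_ (≡ᵇ-true⇒≡ x≡ᵇy) (==ᴸ⇒≡ xs ys e)
==ᴸ⇒≡ [] (_ ∷ _) ()
==ᴸ⇒≡ (_ ∷ _) [] ()

==ᴸ-refl : ∀ xs → (xs ==ᴸ xs) ≡ true
==ᴸ-refl [] = refl
==ᴸ-refl (x ∷ xs) rewrite ≡ᵇ-refl x = ==ᴸ-refl xs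

isEither : ℕ → ℕ → ℕ → Bool
isEither p q x = (x ≡ᵇ p) ∨ (x ≡ᵇ q)

isEither-left : ∀ p q → isEither p q p ≡ true
isEither-left p q rewrite ≡ᵇ-refl p = refl

isEither-right : ∀ p q → isEither p q q ≡ true
isEither-right p q rewrite ≡ᵇ-refl q = ∨-zeroʳ (q ≡ᵇ p)

Alternates : ℕ → ℕ → List ℕ → Set
Alternates p q r = r ≡ p ∷ q ∷ p ∷ q ∷ [] ⊎ r ≡ q ∷ p ∷ q ∷ p ∷ []

interleaves⇒alternates : ∀ w p q → interleaves w p q ≡ true → Alternates p q (filterᵇ (isEither p q) w)
interleaves⇒alternates w p q e with filterᵇ (isEither p q) w ==ᴸ (p ∷ q ∷ p ∷ q ∷ []) in pqpq
... | true = inj₁ (==ᴸ⇒≡ _ _ pqpq)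
... | false = inj₂ (==ᴸ⇒≡ _ _ e)

alternates⇒interleaves : ∀ w p q → Alternates p q (filterᵇ (isEither p q) w) → interleaves w p q ≡ true
alternates⇒interleaves w p q (inj₁ e) rewrite e | ==ᴸ-refl (p ∷ q ∷ p ∷ q ∷ []) = refl
alternates⇒interleaves w p q (inj₂ e) rewrite e | ==ᴸ-refl (q ∷ p ∷ q ∷ p ∷ []) = ∨-zeroʳ _

alternates-rotate : ∀ (a b : ℕ) X Y → X ++ Y ≡ a ∷ b ∷ a ∷ b ∷ [] → Alternates a b (Y ++ X)
alternates-rotate a b [] Y e = inj₁ (trans (++-identityʳ Y) e)
alternates-rotate a b (_ ∷ []) Y e with refl , refl ← ∷-injective e = inj₂ refl
alternates-rotate a b (_ ∷ _ ∷ []) Y e with ∷-injective e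
... | refl , e′ with ∷-injective e′
... | refl , refl = inj₁ refl
alternates-rotate a b (_ ∷ _ ∷ _ ∷ []) Y e with ∷-injective e
... | refl , e′ with ∷-injective e′
... | refl , e″ with ∷-injective e″
... | refl , refl = inj₂ refl
alternates-rotate a b (_ ∷ _ ∷ _ ∷ _ ∷ []) Y e with ∷-injective e
... | refl , e′ with ∷-injective e′
... | refl , e″ with ∷-injective e″
... | refl , e‴ with ∷-injective e‴
... | refl , refl = inj₁ refl
alternates-rotate a b (_ ∷ _ ∷ _ ∷ _ ∷ _ ∷ _) Y ()

interleaves-++-comm : ∀ A B p q → interleaves (A ++ B) p q ≡ true → interleaves (B ++ A) p q ≡ true
interleaves-++-comm A B p q e =
  alternates⇒interleaves (B ++ A) p q (subst (Alternates p q) (sym (filterᵇ-++ (isEither p q) B A)) (rotated alt))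
  where
  fA : List ℕ
  fA = filterᵇ (isEither p q) A
  fB : List ℕ
  fB = filterᵇ (isEither p q) B
  alt : Alternates p q (fA ++ fB)
  alt = subst (Alternates p q) (filterᵇ-++ (isEither p q) A B) (interleaves⇒alternates (A ++ B) p q e)
  rotated : Alternates p q (fA ++ fB) → Alternates p q (fB ++ fA)
  rotated (inj₁ e₁) = alternates-rotate p q fA fB e₁
  rotated (inj₂ e₂) = ⊎.swap (alternates-rotate q p fA fB e₂)

interleaves⇒present : ∀ w p q → interleaves w p q ≡ true → 1 ≤ count p w
interleaves⇒present w p q e =
  subst (1 ≤_) (count-filterᵇ-accept (isEither p q) p w (isEither-left p q)) (present (interleaves⇒alternates w p q e))
  where
  present : Alternates p q (filterᵇ (isEither p q) w) → 1 ≤ count p (filterᵇ (isEither p q) w)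
  present (inj₁ e₁) rewrite e₁ = count-here-pos p (q ∷ p ∷ q ∷ [])
  present (inj₂ e₂) rewrite e₂ = ≤-trans (count-here-pos p (q ∷ p ∷ [])) (count-++ʳ-≤ p (q ∷ []) (p ∷ q ∷ p ∷ []))

alternates-between : ∀ p q fA fB fC → p ≢ q → count p fA ≡ 0 → Alternates p q (fA ++ p ∷ fB ++ p ∷ fC) → fB ≡ q ∷ []
alternates-between p q [] [] fC p≢q _ (inj₁ e) = ⊥-elim (p≢q (∷-injectiveˡ (∷-injectiveʳ e)))
alternates-between p q [] (_ ∷ []) fC p≢q _ (inj₁ e) with refl ← ∷-injectiveˡ (∷-injectiveʳ e) = refl
alternates-between p q [] (_ ∷ _ ∷ fB) fC p≢q _ (inj₁ e) = ⊥-elim (p≢q (only (∷-injectiveʳ (∷-injectiveʳ (∷-injectiveʳ e)))))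
  where
  only : ∀ {fB fC} → fB ++ p ∷ fC ≡ q ∷ [] → p ≡ q
  only {[]} e′ = ∷-injectiveˡ e′
  only {_ ∷ []} ()
  only {_ ∷ _ ∷ _} ()
alternates-between p q (x ∷ fA) fB fC _ pA (inj₁ e) with refl ← ∷-injectiveˡ e = ⊥-elim (0≢1+n (trans (sym pA) (count-here p fA)))
alternates-between p q [] fB fC p≢q _ (inj₂ e) = ⊥-elim (p≢q (∷-injectiveˡ e))
alternates-between p q (_ ∷ []) [] fC p≢q _ (inj₂ e) = ⊥-elim (p≢q (∷-injectiveˡ (∷-injectiveʳ (∷-injectiveʳ e))))
alternates-between p q (_ ∷ []) (_ ∷ []) fC _ _ (inj₂ e) with refl ← ∷-injectiveˡ (∷-injectiveʳ (∷-injectiveʳ e)) = refl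
alternates-between p q (_ ∷ []) (_ ∷ _ ∷ fB) fC _ _ (inj₂ e) =
  ⊥-elim (none (∷-injectiveʳ (∷-injectiveʳ (∷-injectiveʳ (∷-injectiveʳ e)))))
  where
  none : ∀ {fB fC} → fB ++ p ∷ fC ≢ []
  none {[]} ()
  none {_ ∷ _} ()
alternates-between p q (_ ∷ _ ∷ fA) fB fC p≢q pA (inj₂ e) with refl ← ∷-injectiveˡ e | refl ← ∷-injectiveˡ (∷-injectiveʳ e) =
  ⊥-elim (0≢1+n (trans (sym pA) (trans (count-there p q (p ∷ fA) (p≢q ∘ sym)) (count-here p fA))))

alternates-between-count : ∀ (g : ℕ → Bool) p q A B R → g p ≡ true → g q ≡ true → p ≢ q → count p A ≡ 0 →
                           Alternates p q (filterᵇ g (A ++ p ∷ B ++ p ∷ R)) → count q B ≡ 1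
alternates-between-count g p q A B R gp gq p≢q pA alt =
  trans (sym (count-filterᵇ-accept g q B gq)) (trans (cong (count q) middle) (count-here q []))
  where
  split : filterᵇ g (A ++ p ∷ B ++ p ∷ R) ≡ filterᵇ g A ++ p ∷ filterᵇ g B ++ p ∷ filterᵇ g R
  split rewrite filterᵇ-++ g A (p ∷ B ++ p ∷ R) | gp | filterᵇ-++ g B (p ∷ R) | gp = refl
  middle : filterᵇ g B ≡ q ∷ []
  middle = alternates-between p q (filterᵇ g A) (filterᵇ g B) (filterᵇ g R) p≢q
             (trans (count-filterᵇ-accept g p A gp) pA) (subst (Alternates p q) split alt)

interleaves-between : ∀ w p q A B R → w ≡ A ++ p ∷ B ++ p ∷ R → p ≢ q → count p A ≡ 0 →
                      interleaves w p q ≡ true ⊎ interleaves w q p ≡ true → count q B ≡ 1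
interleaves-between w p q A B R refl p≢q pA (inj₁ e) =
  alternates-between-count (isEither p q) p q A B R (isEither-left p q) (isEither-right p q) p≢q pA
    (interleaves⇒alternates w p q e)
interleaves-between w p q A B R refl p≢q pA (inj₂ e) =
  alternates-between-count (isEither q p) p q A B R (isEither-right q p) (isEither-left q p) p≢q pA
    (⊎.swap (interleaves⇒alternates w q p e))

-- Pointer words in which all pointers interleave are squares

at : List ℕ → ℕ → Maybe ℕ
at [] i = nothing
at (x ∷ xs) zero = just x
at (x ∷ xs) (suc i) = at xs i

at-ext : ∀ xs ys → (∀ i → at xs i ≡ at ys i) → xs ≡ ys
at-ext [] [] _ = refl
at-ext [] (y ∷ ys) same with () ← same 0
at-ext (x ∷ xs) [] same with () ← same 0
at-ext (x ∷ xs) (y ∷ ys) same = cong₂ _∷_ (just-injective (same 0)) (at-ext xs ys (same ∘ suc))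

at-++ʳ : ∀ xs ys i → at (xs ++ ys) (length xs + i) ≡ at ys i
at-++ʳ [] ys i = refl
at-++ʳ (x ∷ xs) ys i = at-++ʳ xs ys i

at-take-< : ∀ m xs i → i < m → at (take m xs) i ≡ at xs i
at-take-< (suc m) [] i _ = refl
at-take-< (suc m) (x ∷ xs) zero _ = refl
at-take-< (suc m) (x ∷ xs) (suc i) (s≤s i<m) = at-take-< m xs i i<m

at-take-≥ : ∀ m xs i → m ≤ i → at (take m xs) i ≡ nothing
at-take-≥ zero xs i _ = refl
at-take-≥ (suc m) [] i _ = refl
at-take-≥ (suc m) (x ∷ xs) (suc i) (s≤s m≤i) = at-take-≥ m xs i m≤i

at-drop : ∀ m xs i → at (drop m xs) i ≡ at xs (m + i)
at-drop zero xs i = refl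
at-drop (suc m) [] i = refl
at-drop (suc m) (x ∷ xs) i = at-drop m xs i

at-≥-length : ∀ xs i → length xs ≤ i → at xs i ≡ nothing
at-≥-length [] i _ = refl
at-≥-length (x ∷ xs) (suc i) (s≤s len≤i) = at-≥-length xs i len≤i

at-<-length : ∀ xs i → i < length xs → ∃[ x ] at xs i ≡ just x
at-<-length (x ∷ xs) zero _ = x , refl
at-<-length (x ∷ xs) (suc i) (s≤s i<len) = at-<-length xs i i<len

at⇒present : ∀ xs i p → at xs i ≡ just p → 1 ≤ count p xs
at⇒present (x ∷ xs) zero p e with refl ← just-injective e = count-here-pos x xs
at⇒present (x ∷ xs) (suc i) p e = ≤-trans (at⇒present xs i p e) (count-++ʳ-≤ p (x ∷ []) xs)

at-first : ∀ A p R i → count p A ≡ 0 → at (A ++ p ∷ R) i ≡ just p →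
           i ≡ length A ⊎ ∃[ j ] (i ≡ length A + suc j × at R j ≡ just p)
at-first [] p R zero _ _ = inj₁ refl
at-first [] p R (suc i) _ e = inj₂ (i , refl , e)
at-first (a ∷ A) p R zero pA e with refl ← just-injective e = ⊥-elim (0≢1+n (trans (sym pA) (count-here a A)))
at-first (a ∷ A) p R (suc i) pA e with a ≡ᵇ p
... | false = ⊎.map (cong suc) (λ { (j , i≡ , at≡) → j , cong suc i≡ , at≡ }) (at-first A p R i pA e)

at-twice : ∀ A B Z p i → count p A ≡ 0 → count p B ≡ 0 → count p Z ≡ 0 → at (A ++ p ∷ B ++ p ∷ Z) i ≡ just p →
           i ≡ length A ⊎ i ≡ length A + suc (length B)
at-twice A B Z p i pA pB pZ e with at-first A p (B ++ p ∷ Z) i pA e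
... | inj₁ i≡ = inj₁ i≡
... | inj₂ (j , i≡ , e′) with at-first B p Z j pB e′
...   | inj₁ j≡ = inj₂ (trans i≡ (cong (λ t → length A + suc t) j≡))
...   | inj₂ (k , _ , e″) = ⊥-elim (<-irrefl (sym pZ) (at⇒present Z k p e″))

TwiceAtDistance : ℕ → List ℕ → ℕ → Set
TwiceAtDistance d w x = ∃[ A ] ∃[ B ] ∃[ Z ]
  (w ≡ A ++ x ∷ B ++ x ∷ Z × count x A ≡ 0 × count x B ≡ 0 × count x Z ≡ 0 × suc (length B) ≡ d)

-- The letter at a position i < M has its other occurrence at i + M.
halves-equal : ∀ M w → length w ≡ M + M → (∀ x → 1 ≤ count x w → TwiceAtDistance M w x) → take M w ≡ drop M w
halves-equal M w len twice = at-ext (take M w) (drop M w) same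
  where
  same : ∀ i → at (take M w) i ≡ at (drop M w) i
  same i with i <? M
  ... | no i≮M = begin
    at (take M w) i ≡⟨ at-take-≥ M w i (≮⇒≥ i≮M) ⟩
    nothing         ≡⟨ sym (at-≥-length w (M + i) (subst (_≤ M + i) (sym len) (+-monoʳ-≤ M (≮⇒≥ i≮M)))) ⟩
    at w (M + i)    ≡⟨ sym (at-drop M w i) ⟩
    at (drop M w) i ∎
    where open ≡-Reasoning
  ... | yes i<M with at-<-length w i (subst (i <_) (sym len) (≤-trans i<M (m≤m+n M M)))
  ...   | x , wᵢ≡x with twice x (at⇒present w i x wᵢ≡x)
  ...   | A , B , Z , refl , xA , xB , xZ , dist with at-twice A B Z x i xA xB xZ wᵢ≡x
  ...   | inj₂ i≡ = ⊥-elim (<⇒≱ i<M (subst (M ≤_) (sym i≡) (subst (_≤ length A + suc (length B)) dist (m≤n+m _ (length A)))))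
  ...   | inj₁ refl = begin
    at (take M w) i                         ≡⟨ at-take-< M w i i<M ⟩
    at w i                                  ≡⟨ wᵢ≡x ⟩
    just x                                  ≡⟨ sym (at-++ʳ B (x ∷ Z) 0) ⟩
    at (B ++ x ∷ Z) (length B + 0)          ≡⟨ cong (at (B ++ x ∷ Z)) (+-identityʳ (length B)) ⟩
    at (x ∷ B ++ x ∷ Z) (suc (length B))    ≡⟨ sym (at-++ʳ A (x ∷ B ++ x ∷ Z) (suc (length B))) ⟩
    at w (length A + suc (length B))        ≡⟨ cong (λ d → at w (length A + d)) dist ⟩
    at w (length A + M)                     ≡⟨ cong (at w) (+-comm (length A) M) ⟩
    at w (M + length A)                     ≡⟨ sym (at-drop M w (length A)) ⟩
    at (drop M w) (length A) ∎
    where open ≡-Reasoning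

AllInterleave : ℕ → List ℕ → Set
AllInterleave N w = ∀ p q → 2 ≤ p → p < q → q ≤ N → interleaves w p q ≡ true

module _ {M : ℕ} {π : List ℕ} (rp : IsRangePerm 1 (suc M) π) (all : AllInterleave (suc M) (pointerWord (suc M) π)) where

  private
    W : List ℕ
    W = pointerWord (suc M) π

  count-between : ∀ {x A B Z} → W ≡ A ++ x ∷ B ++ x ∷ Z → count x A ≡ 0 → count x B ≡ 0 → 2 ≤ x → x ≤ suc M →
                  ∀ y → count y (B ++ x ∷ []) ≡ count y (interval 2 M)
  count-between {x} {A} {B} {Z} eW xA xB 2≤x x≤N y = trans (count-++ y B (x ∷ [])) (middle y)
    where
    y∈B⇒y∈W : ∀ y → count y B ≤ count y W
    y∈B⇒y∈W y = begin
      count y B                     ≤⟨ count-++ˡ-≤ y B (x ∷ Z) ⟩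
      count y (B ++ x ∷ Z)          ≤⟨ count-++ʳ-≤ y (x ∷ []) (B ++ x ∷ Z) ⟩
      count y (x ∷ B ++ x ∷ Z)      ≤⟨ count-++ʳ-≤ y A (x ∷ B ++ x ∷ Z) ⟩
      count y (A ++ x ∷ B ++ x ∷ Z) ≡⟨ cong (count y) (sym eW) ⟩
      count y W ∎
      where open ≤-Reasoning
    absent : ∀ y → x ≢ y → count y W ≡ 0 → count y B + count y (x ∷ []) ≡ 0
    absent y x≢y y∉W = cong₂ _+_ (n≤0⇒n≡0 (≤-trans (y∈B⇒y∈W y) (≤-reflexive y∉W))) (count-there y x [] x≢y)
    middle : ∀ y → count y B + count y (x ∷ []) ≡ count y (interval 2 M)
    middle y with y ≟ x
    ... | yes refl = trans (cong₂ _+_ xB (count-here y [])) (sym (count-interval-∈ y 2 M 2≤x (s≤s x≤N)))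
    ... | no y≢x with 2 ≤? y | y ≤? suc M
    ...   | yes 2≤y | yes y≤N =
      trans (cong₂ _+_ (interleaves-between W x y A B Z eW (y≢x ∘ sym) xA either) (count-there y x [] (y≢x ∘ sym)))
            (sym (count-interval-∈ y 2 M 2≤y (s≤s y≤N)))
      where
      either : interleaves W x y ≡ true ⊎ interleaves W y x ≡ true
      either with <-cmp x y
      ... | tri< x<y _ _ = inj₁ (all x y 2≤x x<y y≤N)
      ... | tri≈ _ x≡y _ = ⊥-elim (y≢x (sym x≡y))
      ... | tri> _ _ y<x = inj₂ (all y x 2≤y y<x x≤N)
    ...   | no 2≰y | _ =
      trans (absent y (y≢x ∘ sym) (count-pointerWord-outer rp y (inj₁ (≰⇒> 2≰y)))) (sym (count-interval-< y 2 M (≰⇒> 2≰y)))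
    ...   | yes _ | no y≰N =
      trans (absent y (y≢x ∘ sym) (count-pointerWord-outer rp y (inj₂ (≰⇒> y≰N)))) (sym (count-interval-≥ y 2 M (≰⇒> y≰N)))

  pointerWord-twiceAtDistance : ∀ x → 1 ≤ count x W → TwiceAtDistance M W x
  pointerWord-twiceAtDistance x pos
    with 2≤x , x≤N ← pointerWord-bounds rp x pos
    with A , B , Z , eW , xA , xB , xZ ← count≡2⇒split x W (count-pointerWord-inner rp x 2≤x x≤N)
    = A , B , Z , eW , xA , xB , xZ , distance
    where
    distance : suc (length B) ≡ M
    distance = begin
      suc (length B)            ≡⟨ +-comm 1 (length B) ⟩
      length B + 1              ≡⟨ sym (length-++ B) ⟩
      length (B ++ x ∷ [])      ≡⟨ ↭-length (counts⇒↭ (B ++ x ∷ []) (interval 2 M) (count-between eW xA xB 2≤x x≤N)) ⟩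
      length (interval 2 M)     ≡⟨ length-interval 2 M ⟩
      M ∎
      where open ≡-Reasoning

  pointerWord-halves-equal : take M W ≡ drop M W
  pointerWord-halves-equal = halves-equal M W (length-pointerWord rp) pointerWord-twiceAtDistance

-- Counting valid pointer contexts

filterᵇ-map : ∀ {A B : Set} (g : B → Bool) (f : A → B) xs → filterᵇ g (map f xs) ≡ map f (filterᵇ (g ∘ f) xs)
filterᵇ-map g f [] = refl
filterᵇ-map g f (x ∷ xs) with g (f x)
... | true = cong (f x ∷_) (filterᵇ-map g f xs)
... | false = filterᵇ-map g f xs

filterᵇ-cong : ∀ {A : Set} (g h : A → Bool) xs → All (λ x → g x ≡ h x) xs → filterᵇ g xs ≡ filterᵇ h xs
filterᵇ-cong g h [] [] = refl
filterᵇ-cong g h (x ∷ xs) (gx≡hx ∷ rest) rewrite gx≡hx with h x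
... | true = cong (x ∷_) (filterᵇ-cong g h xs rest)
... | false = filterᵇ-cong g h xs rest

length-filterᵇ-mono : ∀ {A : Set} (g h : A → Bool) xs → (∀ x → g x ≡ true → h x ≡ true) →
                      length (filterᵇ g xs) ≤ length (filterᵇ h xs)
length-filterᵇ-mono g h [] _ = z≤n
length-filterᵇ-mono g h (x ∷ xs) g⇒h with g x in gx | h x in hx
... | true | true = s≤s (length-filterᵇ-mono g h xs g⇒h)
... | true | false with () ← trans (sym hx) (g⇒h x gx)
... | false | true = m≤n⇒m≤1+n (length-filterᵇ-mono g h xs g⇒h)
... | false | false = length-filterᵇ-mono g h xs g⇒h

length-filterᵇ-≡ : ∀ {A : Set} (g h : A → Bool) xs → (∀ x → g x ≡ true → h x ≡ true) →
                   length (filterᵇ g xs) ≡ length (filterᵇ h xs) → All (λ x → h x ≡ true → g x ≡ true) xs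
length-filterᵇ-≡ g h [] _ _ = []
length-filterᵇ-≡ g h (x ∷ xs) g⇒h same with g x in gx | h x in hx
... | true | true = (λ _ → gx) ∷ length-filterᵇ-≡ g h xs g⇒h (suc-injective same)
... | true | false with () ← trans (sym hx) (g⇒h x gx)
... | false | true = ⊥-elim (<-irrefl same (s≤s (length-filterᵇ-mono g h xs g⇒h)))
... | false | false = (λ hx′ → ⊥-elim (false≢true (trans (sym hx) hx′))) ∷ length-filterᵇ-≡ g h xs g⇒h same
  where
  false≢true : false ≢ true
  false≢true ()

length-filterᵇ-cartesianProduct : ∀ (g : ℕ × ℕ → Bool) xs ys →
  length (filterᵇ g (cartesianProduct xs ys)) ≡ sum (map (λ p → length (filterᵇ (λ q → g (p , q)) ys)) xs)
length-filterᵇ-cartesianProduct g [] ys = refl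
length-filterᵇ-cartesianProduct g (x ∷ xs) ys = begin
  length (filterᵇ g (map (x ,_) ys ++ cartesianProduct xs ys))
    ≡⟨ cong length (filterᵇ-++ g (map (x ,_) ys) (cartesianProduct xs ys)) ⟩
  length (filterᵇ g (map (x ,_) ys) ++ filterᵇ g (cartesianProduct xs ys))
    ≡⟨ length-++ (filterᵇ g (map (x ,_) ys)) ⟩
  length (filterᵇ g (map (x ,_) ys)) + length (filterᵇ g (cartesianProduct xs ys))
    ≡⟨ cong₂ _+_ (trans (cong length (filterᵇ-map g (x ,_) ys)) (length-map (x ,_) (filterᵇ (λ q → g (x , q)) ys)))
                 (length-filterᵇ-cartesianProduct g xs ys) ⟩
  length (filterᵇ (λ q → g (x , q)) ys) + sum (map (λ p → length (filterᵇ (λ q → g (p , q)) ys)) xs) ∎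
  where open ≡-Reasoning

length-filterᵇ-false : ∀ {A : Set} (xs : List A) → length (filterᵇ (λ _ → false) xs) ≡ 0
length-filterᵇ-false [] = refl
length-filterᵇ-false (_ ∷ xs) = length-filterᵇ-false xs

<⇒<ᵇ≡true : ∀ {m n} → m < n → (m <ᵇ n) ≡ true
<⇒<ᵇ≡true {zero} {suc n} _ = refl
<⇒<ᵇ≡true {suc m} {suc n} (s≤s m<n) = <⇒<ᵇ≡true m<n

≥⇒<ᵇ≡false : ∀ {m n} → n ≤ m → (m <ᵇ n) ≡ false
≥⇒<ᵇ≡false {m} {zero} _ = refl
≥⇒<ᵇ≡false {suc m} {suc n} (s≤s n≤m) = ≥⇒<ᵇ≡false n≤m

length-filterᵇ-<ᵇ-above : ∀ p a k → p < a → length (filterᵇ (p <ᵇ_) (interval a k)) ≡ k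
length-filterᵇ-<ᵇ-above p a zero _ = refl
length-filterᵇ-<ᵇ-above p a (suc k) p<a rewrite <⇒<ᵇ≡true p<a = cong suc (length-filterᵇ-<ᵇ-above p (suc a) k (m<n⇒m<1+n p<a))

length-filterᵇ-<ᵇ-interval : ∀ p a k → a ≤ p → length (filterᵇ (p <ᵇ_) (interval a k)) ≡ (a + k) ∸ suc p
length-filterᵇ-<ᵇ-interval p a zero a≤p = sym (m≤n⇒m∸n≡0 (≤-trans (≤-reflexive (+-identityʳ a)) (m≤n⇒m≤1+n a≤p)))
length-filterᵇ-<ᵇ-interval p a (suc k) a≤p rewrite ≥⇒<ᵇ≡false {p} {a} a≤p with a ≟ p
... | yes refl = trans (length-filterᵇ-<ᵇ-above a (suc a) k ≤-refl) (sym (trans (cong (_∸ suc a) (+-suc a k)) (m+n∸m≡n (suc a) k)))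
... | no a≢p = trans (length-filterᵇ-<ᵇ-interval p (suc a) k (≤∧≢⇒< a≤p a≢p)) (cong (_∸ suc p) (sym (+-suc a k)))

isPointerPair : ℕ × ℕ → Bool
isPointerPair (p , q) = (1 <ᵇ p) ∧ (p <ᵇ q)

sum-pointerPairs : ∀ a k K → 2 ≤ a → a + k ≡ K →
  sum (map (λ p → length (filterᵇ (λ q → isPointerPair (p , q)) (interval 0 K))) (interval a k)) ≡ k C 2
sum-pointerPairs a zero K _ _ = refl
sum-pointerPairs a (suc k) K 2≤a a+k≡K = begin
  pairsAt a + sum (map pairsAt (interval (suc a) k))
    ≡⟨ cong₂ _+_ first (sum-pointerPairs (suc a) k K (m≤n⇒m≤1+n 2≤a) (trans (sym (+-suc a k)) a+k≡K)) ⟩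
  k + k C 2          ≡⟨ cong (_+ k C 2) (sym (nC1≡n k)) ⟩
  k C 1 + k C 2      ≡⟨ nCk+nC[k+1]≡[n+1]C[k+1] k 1 ⟩
  suc k C 2 ∎
  where
  open ≡-Reasoning
  pairsAt : ℕ → ℕ
  pairsAt p = length (filterᵇ (λ q → isPointerPair (p , q)) (interval 0 K))
  first : pairsAt a ≡ k
  first rewrite <⇒<ᵇ≡true {1} {a} 2≤a =
    trans (length-filterᵇ-<ᵇ-interval a 0 K z≤n) (trans (cong (_∸ suc a) (trans (sym a+k≡K) (+-suc a k))) (m+n∸m≡n (suc a) k))

count-pointerPairs : ∀ M → length (filterᵇ isPointerPair (cartesianProduct (upTo (2 + M)) (upTo (2 + M)))) ≡ M C 2
count-pointerPairs M = begin
  length (filterᵇ isPointerPair (cartesianProduct (upTo K) (upTo K)))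
    ≡⟨ cong (λ l → length (filterᵇ isPointerPair (cartesianProduct l l))) (upTo≡interval K) ⟩
  length (filterᵇ isPointerPair (cartesianProduct (interval 0 K) (interval 0 K)))
    ≡⟨ length-filterᵇ-cartesianProduct isPointerPair (interval 0 K) (interval 0 K) ⟩
  nothingAt + (nothingAt + sum (map pairsAt (interval 2 M)))
    ≡⟨ cong (λ t → t + (t + sum (map pairsAt (interval 2 M)))) (length-filterᵇ-false (interval 0 K)) ⟩
  sum (map pairsAt (interval 2 M))
    ≡⟨ sum-pointerPairs 2 M K ≤-refl refl ⟩
  M C 2 ∎
  where
  open ≡-Reasoning
  K : ℕ
  K = 2 + M
  pairsAt : ℕ → ℕ
  pairsAt p = length (filterᵇ (λ q → isPointerPair (p , q)) (interval 0 K))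
  nothingAt : ℕ
  nothingAt = length (filterᵇ (λ _ → false) (interval 0 K))

∧≡true⇒ˡ : ∀ {a b} → (a ∧ b) ≡ true → a ≡ true
∧≡true⇒ˡ {true} _ = refl

∧≡true⇒ʳ : ∀ {a b} → (a ∧ b) ≡ true → b ≡ true
∧≡true⇒ʳ {true} e = e

isValidContext : ℕ → List ℕ → ℕ × ℕ → Bool
isValidContext N π (p , q) = (p <ᵇ q) ∧ interleaves (pointerWord N π) p q

module _ {M : ℕ} {π : List ℕ} (rp : IsRangePerm 1 (suc M) π) where

  private
    W : List ℕ
    W = pointerWord (suc M) π
    pairs : List (ℕ × ℕ)
    pairs = cartesianProduct (upTo (2 + M)) (upTo (2 + M))

  isValidContext⇒isPointerPair : ∀ pq → isValidContext (suc M) π pq ≡ true → isPointerPair pq ≡ true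
  isValidContext⇒isPointerPair (p , q) valid
    with 2≤p , _ ← pointerWord-bounds rp p (interleaves⇒present W p q (∧≡true⇒ʳ valid))
    rewrite <⇒<ᵇ≡true {1} {p} 2≤p = ∧≡true⇒ˡ valid

  validContexts≡⇒AllInterleave : validContexts (suc M) π ≡ M C 2 → AllInterleave (suc M) W
  validContexts≡⇒AllInterleave maximal p q 2≤p p<q q≤N =
    ∧≡true⇒ʳ (lookup pointerPair⇒valid pq∈pairs pointerPair)
    where
    pointerPair⇒valid : All (λ pq → isPointerPair pq ≡ true → isValidContext (suc M) π pq ≡ true) pairs
    pointerPair⇒valid = length-filterᵇ-≡ (isValidContext (suc M) π) isPointerPair pairs isValidContext⇒isPointerPair
                          (trans maximal (sym (count-pointerPairs M)))
    pq∈pairs : (p , q) ∈ pairs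
    pq∈pairs = ∈-cartesianProduct⁺ (∈-upTo⁺ (≤-trans p<q (m≤n⇒m≤1+n q≤N))) (∈-upTo⁺ (s≤s q≤N))
    pointerPair : isPointerPair (p , q) ≡ true
    pointerPair rewrite <⇒<ᵇ≡true {1} {p} 2≤p = <⇒<ᵇ≡true p<q

  AllInterleave⇒validContexts≡ : AllInterleave (suc M) W → validContexts (suc M) π ≡ M C 2
  AllInterleave⇒validContexts≡ all = trans (cong length (filterᵇ-cong _ _ pairs (tabulate agree′))) (count-pointerPairs M)
    where
    agree : ∀ p q → q ≤ suc M → isValidContext (suc M) π (p , q) ≡ isPointerPair (p , q)
    agree p q q≤N with 2 ≤? p | p <? q
    ... | yes 2≤p | yes p<q rewrite <⇒<ᵇ≡true {1} {p} 2≤p | <⇒<ᵇ≡true p<q = all p q 2≤p p<q q≤N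
    ... | _ | no p≮q rewrite ≥⇒<ᵇ≡false (≮⇒≥ p≮q) = sym (∧-zeroʳ (1 <ᵇ p))
    ... | no 2≰p | yes p<q rewrite ≥⇒<ᵇ≡false {1} {p} (≤-pred (≰⇒> 2≰p)) | <⇒<ᵇ≡true p<q with interleaves W p q in pq
    ...   | false = refl
    ...   | true = ⊥-elim (2≰p (proj₁ (pointerWord-bounds rp p (interleaves⇒present W p q pq))))
    agree′ : ∀ {pq} → pq ∈ pairs → isValidContext (suc M) π pq ≡ isPointerPair pq
    agree′ {p , q} pq∈ = agree p q (≤-pred (∈-upTo⁻ (proj₂ (∈-cartesianProduct⁻ (upTo (2 + M)) (upTo (2 + M)) pq∈))))

-- Permutations in which all pointers interleave

stride : ℕ → ℕ → List ℕ
stride s zero = []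
stride s (suc k) = s ∷ stride (2 + s) k

oddsThenEvens : ℕ → List ℕ
oddsThenEvens n = stride 1 n ++ stride 2 n

+-double-suc : ∀ s k → s + (suc k + suc k) ≡ 2 + s + (k + k)
+-double-suc s k = trans (+-suc s (k + suc k)) (cong suc (trans (cong (s +_) (+-suc k k)) (+-suc s (k + k))))

double≢1 : ∀ k → k + k ≢ 1
double≢1 (suc k) e = 1+n≢0 (trans (sym (+-suc k k)) (suc-injective e))

double≡2⇒≡1 : ∀ k → k + k ≡ 2 → k ≡ 1
double≡2⇒≡1 (suc zero) _ = refl
double≡2⇒≡1 (suc (suc k)) e = ⊥-elim (1+n≢0 (trans (sym (+-suc k (suc k))) (suc-injective (suc-injective e))))

module _ {N : ℕ} (2≤N : 2 ≤ N) where

  pointerWord-head : ∀ m x L r → 2 ≤ x → x ≤ N → pointerWord N (x ∷ L) ≡ m ∷ r → x ≡ m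
  pointerWord-head m x L r 2≤x x≤N e = ∷-injectiveˡ (trans (sym (proj₂ (pointerWord-∷-head 2≤N x L 2≤x x≤N))) e)

  pointerWord-∷-inner-tail : ∀ x L r → 2 ≤ x → x < N → pointerWord N (x ∷ L) ≡ x ∷ r → r ≡ suc x ∷ pointerWord N L
  pointerWord-∷-inner-tail x L r 2≤x x<N e = sym (∷-injectiveʳ (trans (sym (pointerWord-∷-inner 2≤N x L 2≤x x<N)) e))

  mutual
    zipper : ∀ X Y m k → 2 ≤ m → pointerWord N X ≡ m ∷ pointerWord N Y → IsRangePerm m N (X ++ Y) → m + (k + k) ≡ suc N →
             X ≡ stride m k × Y ≡ stride (suc m) k
    zipper [] Y m k _ () _ _
    zipper (x ∷ X) Y m k 2≤m e rp parity
      with m≤x , x≤N ← bounds rp x (count-here-pos x (X ++ Y))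
      with refl ← pointerWord-head m x X _ (≤-trans 2≤m m≤x) x≤N e
      with x ≟ N
    ... | yes refl = ⊥-elim (double≢1 k (+-cancelˡ-≡ x (k + k) 1 (trans parity (+-comm 1 x))))
    ... | no x≢N = zipper′ X Y x k 2≤m (pointerWord-∷-inner-tail x X _ 2≤m (≤∧≢⇒< x≤N x≢N) e) rp parity

    zipper′ : ∀ X Y m k → 2 ≤ m → pointerWord N Y ≡ suc m ∷ pointerWord N X → IsRangePerm m N (m ∷ X ++ Y) →
              m + (k + k) ≡ suc N →
              m ∷ X ≡ stride m k × Y ≡ stride (suc m) k
    zipper′ X [] m k _ () _ _
    zipper′ X (y ∷ Y) m k 2≤m e rp parity
      with m≤y , y≤N ← bounds rp y (≤-trans (count-here-pos y Y) (count-++ʳ-≤ y (m ∷ X) (y ∷ Y)))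
      with refl ← pointerWord-head (suc m) y Y _ (≤-trans 2≤m m≤y) y≤N e
      with suc m ≟ N | k
    ... | yes refl | k′
      with refl ← double≡2⇒≡1 k′ (+-cancelˡ-≡ m (k′ + k′) 2 (trans parity (+-comm 2 m)))
      with X++Y≡[] ← IsRangePerm-empty ≤-refl (IsRangePerm-drop₂ X Y rp)
      rewrite ++-conicalˡ X Y X++Y≡[] | ++-conicalʳ X Y X++Y≡[] = refl , refl
    ... | no _ | zero = ⊥-elim (<-irrefl refl (≤-trans (≤-reflexive (sym (trans (sym (+-identityʳ m)) parity))) (<⇒≤ y≤N)))
    ... | no sm≢N | suc k′
      with refl , refl ← zipper X Y (2 + m) k′ (≤-trans 2≤m (≤-trans (n≤1+n m) (n≤1+n (suc m))))
                           (pointerWord-∷-inner-tail (suc m) Y _ (≤-trans 2≤m (n≤1+n m)) (≤∧≢⇒< y≤N sm≢N) e)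
                           (IsRangePerm-drop₂ X Y rp) (trans (sym (+-double-suc m k′)) parity)
      = refl , refl

AllInterleave-rotate : ∀ N A B → AllInterleave N (pointerWord N (A ++ B)) → AllInterleave N (pointerWord N (B ++ A))
AllInterleave-rotate N A B all p q 2≤p p<q q≤N =
  subst (λ w → interleaves w p q ≡ true) (sym (pointerWord-++ N B A))
    (interleaves-++-comm (pointerWord N A) (pointerWord N B) p q
      (subst (λ w → interleaves w p q ≡ true) (pointerWord-++ N A B) (all p q 2≤p p<q q≤N)))

halves-equal-∷ : ∀ {A : Set} m (a : A) xs → take (suc m) (a ∷ xs) ≡ drop (suc m) (a ∷ xs) → xs ≡ take m xs ++ a ∷ take m xs
halves-equal-∷ m a xs e = trans (sym (take++drop≡id m xs)) (cong (take m xs ++_) (sym e))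

module _ (n₂ : ℕ) where

  private
    n : ℕ
    n = suc (suc n₂)
    N : ℕ
    N = n + n

    2≤N : 2 ≤ N
    2≤N = s≤s (s≤s z≤n)
    2<N : 2 < N
    2<N = s≤s (s≤s (≤-trans (s≤s z≤n) (m≤n+m (suc (suc n₂)) n₂)))

  -- W(1 X 2 Y) = 2 V with V = W(X) 2 3 W(Y); being a square, V = u 2 u, and as 2 occurs once in V
  -- this gives W(X) = 3 W(Y), which the zipper turns into X = 3 5 7 …, Y = 4 6 8 ….
  oddsThenEvens-from-1∷X++2∷Y : ∀ X Y → IsRangePerm 1 N (1 ∷ X ++ 2 ∷ Y) → AllInterleave N (pointerWord N (1 ∷ X ++ 2 ∷ Y)) →
                                1 ∷ X ++ 2 ∷ Y ≡ oddsThenEvens n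
  oddsThenEvens-from-1∷X++2∷Y X Y rp all = cong₂ (λ A B → 1 ∷ A ++ 2 ∷ B) (proj₁ zipped) (proj₂ zipped)
    where
    π : List ℕ
    π = 1 ∷ X ++ 2 ∷ Y
    V : List ℕ
    V = pointerWord N X ++ 2 ∷ 3 ∷ pointerWord N Y
    word : pointerWord N π ≡ 2 ∷ V
    word = trans (pointerWord-∷-one 2≤N (X ++ 2 ∷ Y))
                 (cong (2 ∷_) (trans (pointerWord-++ N X (2 ∷ Y)) (cong (pointerWord N X ++_) (pointerWord-∷-inner 2≤N 2 Y ≤-refl 2<N))))
    u : List ℕ
    u = take (n₂ + suc (suc n₂)) V
    V≡u2u : V ≡ u ++ 2 ∷ u
    V≡u2u = halves-equal-∷ (n₂ + suc (suc n₂)) 2 V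
              (subst (λ w → take (suc n₂ + n) w ≡ drop (suc n₂ + n) w) word (pointerWord-halves-equal rp all))
    once-in-V : count 2 V ≡ 1
    once-in-V = suc-injective (trans (sym (count-here 2 V)) (trans (cong (count 2) (sym word)) (count-pointerWord-inner rp 2 ≤-refl 2≤N)))
    halves : pointerWord N X ≡ u × 3 ∷ pointerWord N Y ≡ u
    halves = first-occurrence-unique 2 (pointerWord N X) (3 ∷ pointerWord N Y) u u V≡u2u
               (count-once-prefix 2 (pointerWord N X) (3 ∷ pointerWord N Y) once-in-V)
               (count-once-prefix 2 u u (trans (cong (count 2) (sym V≡u2u)) once-in-V))
    zipped : X ≡ stride 3 (suc n₂) × Y ≡ stride 4 (suc n₂)
    zipped = zipper 2≤N X Y 3 (suc n₂) (s≤s (s≤s z≤n)) (trans (proj₁ halves) (sym (proj₂ halves)))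
               (IsRangePerm-drop₂ X Y rp) (cong (3 +_) (sym (+-suc n₂ (suc n₂))))

  rotation-of-oddsThenEvens : ∀ π → IsRangePerm 1 N π → AllInterleave N (pointerWord N π) →
                              ∃[ A ] ∃[ B ] (π ≡ A ++ 1 ∷ B × (1 ∷ B) ++ A ≡ oddsThenEvens n)
  rotation-of-oddsThenEvens π rp all
    with A , B , refl , _ ← first-occurrence 1 π (≤-reflexive (sym (once rp 1 ≤-refl (s≤s z≤n))))
    with X , Y , B++A≡ , _ ← first-occurrence 2 (B ++ A) (≤-reflexive (sym (once (IsRangePerm-++-comm A (1 ∷ B) rp) 2 (s≤s z≤n) 2≤N)))
    = A , B , refl , trans (cong (1 ∷_) B++A≡) (oddsThenEvens-from-1∷X++2∷Y X Y rp′ all′)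
    where
    rp′ : IsRangePerm 1 N (1 ∷ X ++ 2 ∷ Y)
    rp′ = subst (IsRangePerm 1 N ∘ (1 ∷_)) B++A≡ (IsRangePerm-++-comm A (1 ∷ B) rp)
    all′ : AllInterleave N (pointerWord N (1 ∷ X ++ 2 ∷ Y))
    all′ = subst (λ l → AllInterleave N (pointerWord N (1 ∷ l))) B++A≡ (AllInterleave-rotate N A (1 ∷ B) all)

-- All pointers interleave in the rotations of 1 3 5 … 2 4 6 …

stride-interleave-↭ : ∀ s k → stride s k ++ stride (suc s) k ↭ interval s (k + k)
stride-interleave-↭ s zero = ↭-refl
stride-interleave-↭ s (suc k) = begin
  s ∷ stride (2 + s) k ++ suc s ∷ stride (3 + s) k   ↭⟨ prep s (shift (suc s) (stride (2 + s) k) (stride (3 + s) k)) ⟩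
  s ∷ suc s ∷ stride (2 + s) k ++ stride (3 + s) k   ↭⟨ prep s (prep (suc s) (stride-interleave-↭ (2 + s) k)) ⟩
  interval s (2 + (k + k))                            ≡⟨ cong (interval s) (cong suc (sym (+-suc k k))) ⟩
  interval s (suc k + suc k)                          ∎
  where open PermutationReasoning

oddsThenEvens-isRangePerm : ∀ n → IsRangePerm 1 (n + n) (oddsThenEvens n)
oddsThenEvens-isRangePerm n = IsRangePerm-↭ (stride-interleave-↭ 1 n) (interval-isRangePerm 0 (n + n))

pointers-stride : ∀ s k → pointers (stride s k) ≡ interval s (k + k)
pointers-stride s zero = refl
pointers-stride s (suc k) = trans (cong (λ r → s ∷ suc s ∷ r) (pointers-stride (2 + s) k)) (cong (interval s) (cong suc (sym (+-suc k k))))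

filterᵇ-interval-all : ∀ (g : ℕ → Bool) a k → (∀ i → i < k → g (a + i) ≡ true) → filterᵇ g (interval a k) ≡ interval a k
filterᵇ-interval-all g a zero _ = refl
filterᵇ-interval-all g a (suc k) all =
  trans (filterᵇ-accept g a (interval (suc a) k) (subst (λ t → g t ≡ true) (+-identityʳ a) (all 0 z<s)))
        (cong (a ∷_) (filterᵇ-interval-all g (suc a) k (λ i i<k → subst (λ t → g t ≡ true) (+-suc a i) (all (suc i) (s≤s i<k)))))

pointerWord-oddsThenEvens : ∀ n₁ → pointerWord (suc n₁ + suc n₁) (oddsThenEvens (suc n₁)) ≡
                                  interval 2 (n₁ + suc n₁) ++ interval 2 (n₁ + suc n₁)
pointerWord-oddsThenEvens n₁ = begin
  filterᵇ inner (pointers (stride 1 n ++ stride 2 n))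
    ≡⟨ cong (filterᵇ inner) (trans (concatMap-++ (λ k → k ∷ suc k ∷ []) (stride 1 n) (stride 2 n))
                                   (cong₂ _++_ (pointers-stride 1 n) (pointers-stride 2 n))) ⟩
  filterᵇ inner (interval 1 N ++ interval 2 N)
    ≡⟨ filterᵇ-++ inner (interval 1 N) (interval 2 N) ⟩
  filterᵇ inner (interval 2 m) ++ filterᵇ inner (interval 2 N)
    ≡⟨ cong (filterᵇ inner (interval 2 m) ++_)
            (trans (cong (filterᵇ inner) (interval-∷ʳ 2 m)) (filterᵇ-++ inner (interval 2 m) (suc N ∷ []))) ⟩
  filterᵇ inner (interval 2 m) ++ filterᵇ inner (interval 2 m) ++ filterᵇ inner (suc N ∷ [])
    ≡⟨ cong (λ r → filterᵇ inner (interval 2 m) ++ filterᵇ inner (interval 2 m) ++ r)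
            (filterᵇ-reject inner (suc N) [] (isInner-reject-suc N)) ⟩
  filterᵇ inner (interval 2 m) ++ filterᵇ inner (interval 2 m) ++ []
    ≡⟨ cong₂ _++_ inner-all (trans (++-identityʳ _) inner-all) ⟩
  interval 2 m ++ interval 2 m ∎
  where
  open ≡-Reasoning
  n : ℕ
  n = suc n₁
  m : ℕ
  m = n₁ + suc n₁
  N : ℕ
  N = suc m
  inner : ℕ → Bool
  inner = isInner N
  inner-all : filterᵇ inner (interval 2 m) ≡ interval 2 m
  inner-all = filterᵇ-interval-all inner 2 m (λ i i<m → isInner-accept N (2 + i) (s≤s (s≤s z≤n)) (s≤s i<m))

isEither-reject : ∀ p q x → x ≢ p → x ≢ q → isEither p q x ≡ false
isEither-reject p q x x≢p x≢q rewrite ≢⇒≡ᵇ-false x≢p | ≢⇒≡ᵇ-false x≢q = refl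

module _ {p q : ℕ} (p<q : p < q) where

  filterᵇ-isEither-above : ∀ a k → q < a → filterᵇ (isEither p q) (interval a k) ≡ []
  filterᵇ-isEither-above a zero _ = refl
  filterᵇ-isEither-above a (suc k) q<a =
    trans (filterᵇ-reject (isEither p q) a (interval (suc a) k)
             (isEither-reject p q a (λ { refl → <-asym p<q q<a }) (λ { refl → <-irrefl refl q<a })))
          (filterᵇ-isEither-above (suc a) k (m<n⇒m<1+n q<a))

  filterᵇ-isEither-second : ∀ a k → p < a → a ≤ q → q < a + k → filterᵇ (isEither p q) (interval a k) ≡ q ∷ []
  filterᵇ-isEither-second a zero _ a≤q q<a+0 = ⊥-elim (<⇒≱ q<a+0 (subst (_≤ q) (sym (+-identityʳ a)) a≤q))
  filterᵇ-isEither-second a (suc k) p<a a≤q q<a+sk with a ≟ q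
  ... | yes refl = trans (filterᵇ-accept (isEither p a) a (interval (suc a) k) (isEither-right p a))
                         (cong (a ∷_) (filterᵇ-isEither-above (suc a) k ≤-refl))
  ... | no a≢q = trans (filterᵇ-reject (isEither p q) a (interval (suc a) k) (isEither-reject p q a (λ { refl → <-irrefl refl p<a }) a≢q))
                       (filterᵇ-isEither-second (suc a) k (m<n⇒m<1+n p<a) (≤∧≢⇒< a≤q a≢q) (subst (q <_) (+-suc a k) q<a+sk))

  filterᵇ-isEither-interval : ∀ a k → a ≤ p → q < a + k → filterᵇ (isEither p q) (interval a k) ≡ p ∷ q ∷ []
  filterᵇ-isEither-interval a zero a≤p q<a+0 = ⊥-elim (<⇒≱ q<a+0 (subst (_≤ q) (sym (+-identityʳ a)) (≤-trans a≤p (<⇒≤ p<q))))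
  filterᵇ-isEither-interval a (suc k) a≤p q<a+sk with a ≟ p
  ... | yes refl = trans (filterᵇ-accept (isEither a q) a (interval (suc a) k) (isEither-left a q))
                         (cong (a ∷_) (filterᵇ-isEither-second (suc a) k ≤-refl p<q (subst (q <_) (+-suc a k) q<a+sk)))
  ... | no a≢p = trans (filterᵇ-reject (isEither p q) a (interval (suc a) k)
                          (isEither-reject p q a a≢p (λ { refl → <-asym (≤∧≢⇒< a≤p a≢p) p<q })))
                       (filterᵇ-isEither-interval (suc a) k (≤∧≢⇒< a≤p a≢p) (subst (q <_) (+-suc a k) q<a+sk))

oddsThenEvens-AllInterleave : ∀ n₁ → AllInterleave (suc n₁ + suc n₁) (pointerWord (suc n₁ + suc n₁) (oddsThenEvens (suc n₁)))
oddsThenEvens-AllInterleave n₁ p q 2≤p p<q q≤N =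
  alternates⇒interleaves W p q (inj₁ (begin
    filterᵇ (isEither p q) W                                            ≡⟨ cong (filterᵇ (isEither p q)) (pointerWord-oddsThenEvens n₁) ⟩
    filterᵇ (isEither p q) (interval 2 m ++ interval 2 m)               ≡⟨ filterᵇ-++ (isEither p q) (interval 2 m) (interval 2 m) ⟩
    filterᵇ (isEither p q) (interval 2 m) ++ filterᵇ (isEither p q) (interval 2 m)
      ≡⟨ cong (λ r → r ++ r) (filterᵇ-isEither-interval p<q 2 m 2≤p (s≤s q≤N)) ⟩
    p ∷ q ∷ p ∷ q ∷ [] ∎))
  where
  open ≡-Reasoning
  m : ℕ
  m = n₁ + suc n₁
  W : List ℕ
  W = pointerWord (suc m) (oddsThenEvens (suc n₁))

rotation-AllInterleave : ∀ n₁ P Q → P ++ Q ≡ oddsThenEvens (suc n₁) →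
                         AllInterleave (suc n₁ + suc n₁) (pointerWord (suc n₁ + suc n₁) (Q ++ P))
rotation-AllInterleave n₁ P Q P++Q≡ =
  AllInterleave-rotate (suc n₁ + suc n₁) P Q
    (subst (λ l → AllInterleave (suc n₁ + suc n₁) (pointerWord (suc n₁ + suc n₁) l)) (sym P++Q≡) (oddsThenEvens-AllInterleave n₁))

-- Strategic piles of the rotations of 1 3 5 … 2 4 6 …

module _ (N : ℕ) (ρ : List ℕ) where

  WalkLength : ℕ → ℕ → ℕ → Set
  WalkLength fuel x m = ∃[ l ] (walk fuel N ρ x ≡ just l × length l ≡ m)

  walkLength-zero : ∀ fuel → WalkLength (suc fuel) 0 0
  walkLength-zero fuel = [] , refl , refl

  walkLength-step : ∀ fuel x m → x ≢ 0 → x ≢ N → WalkLength fuel (Cπ N ρ x) m → WalkLength (suc fuel) x (suc m)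
  walkLength-step fuel x m x≢0 x≢N (l , walk≡ , len) = x ∷ l , walk-x , cong suc len
    where
    walk-x : walk (suc fuel) N ρ x ≡ just (x ∷ l)
    walk-x rewrite ≢⇒≡ᵇ-false x≢0 | ≢⇒≡ᵇ-false x≢N | walk≡ = refl

  walkLength-descending : ∀ d lo fuel m → WalkLength fuel lo m →
                          (∀ i → i < d → Cπ N ρ (suc (lo + i)) ≡ lo + i) → (∀ i → i < d → suc (lo + i) ≢ N) →
                          WalkLength (d + fuel) (lo + d) (d + m)
  walkLength-descending zero lo fuel m w _ _ = subst (λ t → WalkLength fuel t m) (sym (+-identityʳ lo)) w
  walkLength-descending (suc d) lo fuel m w down inner =
    subst (λ t → WalkLength (suc (d + fuel)) t (suc (d + m))) (sym (+-suc lo d))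
      (walkLength-step (d + fuel) (suc (lo + d)) (d + m) (λ ()) (inner d ≤-refl)
        (subst (λ t → WalkLength (d + fuel) t (d + m)) (sym (down d ≤-refl))
          (walkLength-descending d lo fuel m w (λ i i<d → down i (m<n⇒m<1+n i<d)) (λ i i<d → inner i (m<n⇒m<1+n i<d)))))

  walk-more-fuel : ∀ fuel extra x l → walk fuel N ρ x ≡ just l → walk (fuel + extra) N ρ x ≡ just l
  walk-more-fuel (suc fuel) extra x l w with x ≡ᵇ 0
  ... | true = w
  ... | false with x ≡ᵇ N
  ...   | true = w
  ...   | false with walk fuel N ρ (Cπ N ρ x) in w′
  ...     | just l′ rewrite walk-more-fuel fuel extra (Cπ N ρ x) l′ w′ = w

  SP-length : ∀ fuel m → fuel ≤ 2 + N → WalkLength fuel (Cπ N ρ N) m → length (SP N ρ) ≡ m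
  SP-length fuel m fuel≤ (l , w , len) with walk-more-fuel fuel (2 + N ∸ fuel) (Cπ N ρ N) l w
  ... | w′ rewrite m+[n∸m]≡n fuel≤ | w′ = len

predIn-skip : ∀ u L R x → count x L ≡ 0 → predIn (u ∷ L ++ R) x ≡ predIn (lastOr u L ∷ R) x
predIn-skip u [] R x _ = refl
predIn-skip u (v ∷ L) R x xL with v ≡ᵇ x
... | false = predIn-skip v L R x xL

predIn-prefix : ∀ u L R x → 1 ≤ count x L → predIn (u ∷ L ++ R) x ≡ predIn (u ∷ L) x
predIn-prefix u (v ∷ L) R x x∈ with v ≡ᵇ x
... | true = refl
... | false with L
...   | w ∷ L′ = predIn-prefix v (w ∷ L′) R x x∈

lastOr-++ : ∀ d L R → lastOr d (L ++ R) ≡ lastOr (lastOr d L) R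
lastOr-++ d [] R = refl
lastOr-++ d (x ∷ L) R = lastOr-++ x L R

predIn-head : ∀ u a L y → a ≢ y → predIn (u ∷ a ∷ L) y ≡ predIn (a ∷ L) y
predIn-head u a L y a≢y rewrite ≢⇒≡ᵇ-false a≢y = refl

cyclicPred : List ℕ → ℕ → ℕ
cyclicPred π = predIn (lastOr 0 π ∷ π)

module Rotation (P : List ℕ) (a : ℕ) (Q′ : List ℕ) (at-most-once : ∀ y → count y (P ++ a ∷ Q′) ≤ 1) where

  private
    π : List ℕ
    π = P ++ a ∷ Q′
    l : ℕ
    l = lastOr 0 π

  predIn-rotation : ∀ y → 1 ≤ count y π → y ≢ a → predIn (0 ∷ a ∷ Q′ ++ P) y ≡ cyclicPred π y
  predIn-rotation y y∈π y≢a with count y (a ∷ Q′) ≟ 0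
  ... | yes y∉Q = begin
    predIn (0 ∷ a ∷ Q′ ++ P) y   ≡⟨ predIn-skip 0 (a ∷ Q′) P y y∉Q ⟩
    predIn (lastOr a Q′ ∷ P) y   ≡⟨ cong (λ t → predIn (t ∷ P) y) (sym (lastOr-++ 0 P (a ∷ Q′))) ⟩
    predIn (l ∷ P) y             ≡⟨ sym (predIn-prefix l P (a ∷ Q′) y y∈P) ⟩
    predIn (l ∷ π) y             ∎
    where
    open ≡-Reasoning
    y∈P : 1 ≤ count y P
    y∈P = subst (1 ≤_) (trans (count-++ y P (a ∷ Q′)) (trans (cong (count y P +_) y∉Q) (+-identityʳ _))) y∈π
  ... | no y∈Q = begin
    predIn (0 ∷ a ∷ Q′ ++ P) y          ≡⟨ predIn-prefix 0 (a ∷ Q′) P y (n≢0⇒n>0 y∈Q) ⟩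
    predIn (0 ∷ a ∷ Q′) y               ≡⟨ predIn-head 0 a Q′ y (y≢a ∘ sym) ⟩
    predIn (a ∷ Q′) y                   ≡⟨ sym (predIn-head (lastOr l P) a Q′ y (y≢a ∘ sym)) ⟩
    predIn (lastOr l P ∷ a ∷ Q′) y
      ≡⟨ sym (predIn-skip l P (a ∷ Q′) y (count-++-exclusive y P (a ∷ Q′) (at-most-once y) (n≢0⇒n>0 y∈Q))) ⟩
    predIn (l ∷ π) y                    ∎
    where open ≡-Reasoning

  predIn-rotation-head : predIn (0 ∷ a ∷ Q′ ++ P) a ≡ 0
  predIn-rotation-head rewrite ≡ᵇ-refl a = refl

  lastOr-rotation : lastOr 0 (a ∷ Q′ ++ P) ≡ cyclicPred π a
  lastOr-rotation = begin
    lastOr a (Q′ ++ P)             ≡⟨ lastOr-++ a Q′ P ⟩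
    lastOr (lastOr a Q′) P         ≡⟨ cong (λ t → lastOr t P) (sym (lastOr-++ 0 P (a ∷ Q′))) ⟩
    lastOr l P                     ≡⟨ sym (predIn-self (lastOr l P) a Q′) ⟩
    predIn (lastOr l P ∷ a ∷ Q′) a ≡⟨ sym (predIn-skip l P (a ∷ Q′) a a∉P) ⟩
    predIn (l ∷ π) a               ∎
    where
    open ≡-Reasoning
    predIn-self : ∀ u a L → predIn (u ∷ a ∷ L) a ≡ u
    predIn-self u a L rewrite ≡ᵇ-refl a = refl
    a∉P : count a P ≡ 0
    a∉P = count-++-exclusive a P (a ∷ Q′) (at-most-once a) (count-here-pos a Q′)

lastOr-stride : ∀ d s k → lastOr d (stride s (suc k)) ≡ s + (k + k)
lastOr-stride d s zero = sym (+-identityʳ s)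
lastOr-stride d s (suc k) = trans (lastOr-stride s (2 + s) k) (sym (+-double-suc s k))

predIn-stride : ∀ s k u i → suc i < k → predIn (u ∷ stride s k) (2 + (s + (i + i))) ≡ s + (i + i)
predIn-stride s (suc (suc k)) u zero _
  rewrite ≢⇒≡ᵇ-false {s} {2 + (s + 0)} (λ e → <-irrefl e (s≤s (≤-trans (≤-reflexive (sym (+-identityʳ s))) (n≤1+n _))))
        | +-identityʳ s | ≡ᵇ-refl s = refl
predIn-stride s (suc k) u (suc i) (s≤s i<k)
  rewrite ≢⇒≡ᵇ-false {s} {2 + (s + (suc i + suc i))} (λ e → <-irrefl e (s≤s (≤-trans (m≤m+n s _) (n≤1+n _)))) =
  trans (cong (λ t → predIn (s ∷ stride (2 + s) k) (2 + t)) (+-double-suc s i))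
        (trans (predIn-stride (2 + s) k s i i<k) (sym (+-double-suc s i)))

stride-∈ : ∀ s k i → i < k → 1 ≤ count (s + (i + i)) (stride s k)
stride-∈ s (suc k) zero _ rewrite +-identityʳ s = count-here-pos s (stride (2 + s) k)
stride-∈ s (suc k) (suc i) (s≤s i<k) =
  ≤-trans (subst (λ t → 1 ≤ count t (stride (2 + s) k)) (sym (+-double-suc s i)) (stride-∈ (2 + s) k i i<k))
          (count-++ʳ-≤ (s + (suc i + suc i)) (s ∷ []) (stride (2 + s) k))

even⊎odd : ∀ j → ∃[ i ] (j ≡ i + i ⊎ j ≡ suc (i + i))
even⊎odd zero = 0 , inj₁ refl
even⊎odd (suc zero) = 0 , inj₂ refl
even⊎odd (suc (suc j)) with even⊎odd j
... | i , inj₁ refl = suc i , inj₁ (cong suc (sym (+-suc i i)))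
... | i , inj₂ refl = suc i , inj₂ (cong (suc ∘ suc) (sym (+-suc i i)))

half-< : ∀ i m → suc (i + i) ≤ m + m → i < m
half-< i m le with i <? m
... | yes i<m = i<m
... | no i≮m = ⊥-elim (<⇒≱ le (+-mono-≤ (≮⇒≥ i≮m) (≮⇒≥ i≮m)))

module _ (n₁ : ℕ) where

  private
    n : ℕ
    n = suc n₁
    π : List ℕ
    π = oddsThenEvens n

  lastOr-oddsThenEvens : lastOr 0 π ≡ n + n
  lastOr-oddsThenEvens =
    trans (lastOr-++ 0 (stride 1 n) (stride 2 n)) (trans (lastOr-stride (lastOr 0 (stride 1 n)) 2 n₁) (cong suc (sym (+-suc n₁ n₁))))

  private
    evens-not-odd : ∀ y → 1 ≤ count y (stride 2 n) → count y (stride 1 n) ≡ 0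
    evens-not-odd y = count-++-exclusive y (stride 1 n) (stride 2 n) (at-most-once (oddsThenEvens-isRangePerm n) y)

  cyclicPred-oddsThenEvens-2 : cyclicPred π 2 ≡ suc (n₁ + n₁)
  cyclicPred-oddsThenEvens-2 =
    trans (predIn-skip (lastOr 0 π) (stride 1 n) (stride 2 n) 2 (evens-not-odd 2 (count-here-pos 2 (stride 4 n₁))))
          (lastOr-stride (lastOr 0 π) 1 n₁)

  cyclicPred-oddsThenEvens-≥3 : ∀ y → 3 ≤ y → y ≤ n + n → cyclicPred π y ≡ y ∸ 2
  cyclicPred-oddsThenEvens-≥3 (suc (suc zero)) (s≤s (s≤s ())) _
  cyclicPred-oddsThenEvens-≥3 (suc (suc (suc j))) _ y≤N with even⊎odd j
  ... | i , inj₁ refl =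
    trans (predIn-prefix (lastOr 0 π) (stride 1 n) (stride 2 n) (3 + (i + i))
             (subst (λ t → 1 ≤ count t (stride 1 n)) (+-double-suc 1 i) (stride-∈ 1 n (suc i) (s≤s i<n₁))))
          (predIn-stride 1 n (lastOr 0 π) i (s≤s i<n₁))
    where
    i<n₁ : i < n₁
    i<n₁ = half-< i n₁ (≤-pred (≤-pred (subst (3 + (i + i) ≤_) (cong suc (+-suc n₁ n₁)) y≤N)))
  ... | i , inj₂ refl =
    trans (predIn-skip (lastOr 0 π) (stride 1 n) (stride 2 n) (4 + (i + i))
             (evens-not-odd (4 + (i + i)) (subst (λ t → 1 ≤ count t (stride 2 n)) (+-double-suc 2 i) (stride-∈ 2 n (suc i) (s≤s i<n₁)))))
          (predIn-stride 2 n (lastOr (lastOr 0 π) (stride 1 n)) i (s≤s i<n₁))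
    where
    i<n₁ : i < n₁
    i<n₁ = half-< i n₁ (≤-trans (n≤1+n _) (≤-pred (≤-pred (subst (4 + (i + i) ≤_) (cong suc (+-suc n₁ n₁)) y≤N))))

X-< : ∀ N x → x < N → X N x ≡ suc x
X-< N x x<N rewrite <⇒<ᵇ≡true x<N = refl

X-self : ∀ N → X N N ≡ 0
X-self N rewrite ≥⇒<ᵇ≡false {N} {N} ≤-refl = refl

-- C counts down by one on [2, N) except that a - 1 ↦ 0, while 1 ↦ N - 1 and N ↦ a - 2 (N - 1 if a = 2),
-- so the cycle of C from N passes through all of 1 … N - 1 before reaching 0.
module DescendingCycle (m : ℕ) (ρ : List ℕ) (a : ℕ) (2≤a : 2 ≤ a) (a≤N : a ≤ 2 + m)
  (C-down : ∀ x → 2 ≤ x → x < 2 + m → suc x ≢ a → Cπ (2 + m) ρ x ≡ pred x)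
  (C-one : a ≢ 2 → Cπ (2 + m) ρ 1 ≡ suc m)
  (C-end : ∀ x → suc x ≡ a → Cπ (2 + m) ρ x ≡ 0)
  (C-top-2 : a ≡ 2 → Cπ (2 + m) ρ (2 + m) ≡ suc m)
  (C-top-≥3 : 3 ≤ a → Cπ (2 + m) ρ (2 + m) ≡ a ∸ 2) where

  private
    N : ℕ
    N = 2 + m
    C : ℕ → ℕ
    C = Cπ N ρ

  SP-length-a≡2 : a ≡ 2 → length (SP N ρ) ≡ suc m
  SP-length-a≡2 refl = trans (SP-length N ρ (m + 2) (m + 1) fuel≤ from-top) (+-comm m 1)
    where
    fuel≤ : m + 2 ≤ 2 + N
    fuel≤ = ≤-trans (≤-reflexive (+-comm m 2)) (s≤s (s≤s (≤-trans (n≤1+n m) (n≤1+n (suc m)))))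
    from-one : WalkLength N ρ 2 1 1
    from-one = walkLength-step N ρ 1 1 0 (λ ()) (λ ()) (subst (λ t → WalkLength N ρ 1 t 0) (sym (C-end 1 refl)) (walkLength-zero N ρ 0))
    from-top : WalkLength N ρ (m + 2) (C N) (m + 1)
    from-top = subst (λ t → WalkLength N ρ (m + 2) t (m + 1)) (sym (C-top-2 refl))
                 (walkLength-descending N ρ m 1 2 1 from-one (λ i i<m → C-down (2 + i) (s≤s (s≤s z≤n)) (s≤s (s≤s i<m)) (λ ()))
                   (λ i i<m e → <-irrefl (suc-injective (suc-injective e)) i<m))

  SP-length-a≥3 : ∀ a′ → a ≡ 3 + a′ → length (SP N ρ) ≡ suc m
  SP-length-a≥3 a′ refl = trans (SP-length N ρ (a′ + suc (d + 2)) (a′ + suc (d + 1)) fuel≤ from-top) (trans (a′+d 1) (+-comm m 1))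
    where
    a′<m : a′ < m
    a′<m = ≤-pred (≤-pred a≤N)
    d : ℕ
    d = m ∸ suc a′
    a′+d : ∀ k → a′ + suc (d + k) ≡ m + k
    a′+d k = trans (+-suc a′ (d + k)) (trans (cong suc (sym (+-assoc a′ d k))) (cong (_+ k) (m+[n∸m]≡n a′<m)))
    fuel≤ : a′ + suc (d + 2) ≤ 2 + N
    fuel≤ = ≤-trans (≤-reflexive (a′+d 2)) (≤-trans (≤-reflexive (+-comm m 2)) (s≤s (s≤s (≤-trans (n≤1+n m) (n≤1+n (suc m))))))
    lo : ℕ
    lo = 2 + a′
    lo+d : lo + d ≡ suc m
    lo+d = cong suc (m+[n∸m]≡n a′<m)
    upper-down : ∀ i → i < d → C (suc (lo + i)) ≡ lo + i
    upper-down i i<d = C-down (suc (lo + i)) (s≤s (s≤s z≤n)) (s≤s (subst (lo + i <_) lo+d (+-monoʳ-< lo i<d)))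
                         (λ e → <-irrefl (sym (suc-injective (suc-injective (suc-injective e)))) (s≤s (m≤m+n a′ i)))
    upper-inner : ∀ i → i < d → suc (lo + i) ≢ N
    upper-inner i i<d e = <-irrefl (suc-injective e) (subst (lo + i <_) lo+d (+-monoʳ-< lo i<d))
    lower-down : ∀ i → i < a′ → C (suc (1 + i)) ≡ 1 + i
    lower-down i i<a′ = C-down (2 + i) (s≤s (s≤s z≤n)) (s≤s (s≤s (≤-trans i<a′ (≤-trans (n≤1+n a′) a′<m))))
                          (λ e → <-irrefl (suc-injective (suc-injective (suc-injective e))) i<a′)
    lower-inner : ∀ i → i < a′ → suc (1 + i) ≢ N
    lower-inner i i<a′ e = <-irrefl (suc-injective (suc-injective e)) (<-trans i<a′ a′<m)
    from-below-a : WalkLength N ρ 2 lo 1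
    from-below-a = walkLength-step N ρ 1 lo 0 (λ ()) (λ e → <-irrefl (suc-injective (suc-injective e)) a′<m)
                     (subst (λ t → WalkLength N ρ 1 t 0) (sym (C-end lo refl)) (walkLength-zero N ρ 0))
    from-one : WalkLength N ρ (suc (d + 2)) 1 (suc (d + 1))
    from-one = walkLength-step N ρ (d + 2) 1 (d + 1) (λ ()) (λ ())
                 (subst (λ t → WalkLength N ρ (d + 2) t (d + 1)) (trans lo+d (sym (C-one (λ ()))))
                   (walkLength-descending N ρ d lo 2 1 from-below-a upper-down upper-inner))
    from-top : WalkLength N ρ (a′ + suc (d + 2)) (C N) (a′ + suc (d + 1))
    from-top = subst (λ t → WalkLength N ρ (a′ + suc (d + 2)) t (a′ + suc (d + 1))) (sym (C-top-≥3 (s≤s (s≤s (s≤s z≤n)))))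
                 (walkLength-descending N ρ a′ 1 (suc (d + 2)) (suc (d + 1)) from-one lower-down lower-inner)

  SP-length-maximal : length (SP N ρ) ≡ suc m
  SP-length-maximal with a ≟ 2
  ... | yes a≡2 = SP-length-a≡2 a≡2
  ... | no a≢2 = SP-length-a≥3 (a ∸ 3) (sym (m+[n∸m]≡n (≤∧≢⇒< 2≤a (a≢2 ∘ sym))))

module _ (n₂ : ℕ) where

  private
    n : ℕ
    n = 2 + n₂
    m : ℕ
    m = n₂ + suc (suc n₂)
    N : ℕ
    N = n + n
    π : List ℕ
    π = oddsThenEvens n
    rp : IsRangePerm 1 N π
    rp = oddsThenEvens-isRangePerm n

  SP-oddsThenEvens : length (SP N π) ≡ 0
  SP-oddsThenEvens rewrite X-self N | lastOr-oddsThenEvens (suc n₂) | ≡ᵇ-refl N = refl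

  module RotatedOddsThenEvens (p : ℕ) (P : List ℕ) (a : ℕ) (Q : List ℕ) (π′≡π : (p ∷ P) ++ a ∷ Q ≡ π) where

    private
      π′ : List ℕ
      π′ = (p ∷ P) ++ a ∷ Q
      rp′ : IsRangePerm 1 N π′
      rp′ = subst (IsRangePerm 1 N) (sym π′≡π) rp
      open Rotation (p ∷ P) a Q (at-most-once rp′)

    ρ : List ℕ
    ρ = a ∷ Q ++ p ∷ P
    cyclicPred-π′ : ∀ y → cyclicPred π′ y ≡ cyclicPred π y
    cyclicPred-π′ y = cong (λ l → cyclicPred l y) π′≡π
    a∈π′ : 1 ≤ count a π′
    a∈π′ = ≤-trans (count-here-pos a Q) (count-++ʳ-≤ a (p ∷ P) (a ∷ Q))
    a≤N : a ≤ N
    a≤N = proj₂ (bounds rp′ a a∈π′)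
    2≤a : 2 ≤ a
    2≤a with bounds rp′ a a∈π′ | a ≟ 1
    ... | 1≤a , _ | no a≢1 = ≤∧≢⇒< 1≤a (a≢1 ∘ sym)
    ... | _ | yes refl with refl ← ∷-injectiveˡ π′≡π = ⊥-elim (<-irrefl refl (≤-trans twice (at-most-once rp′ 1)))
      where
      twice : 2 ≤ count 1 π′
      twice = subst (2 ≤_) (sym (trans (count-here 1 (P ++ 1 ∷ Q)) (cong suc (count-split 1 P Q))))
                (s≤s (≤-trans (s≤s z≤n) (m≤n+m (suc (count 1 Q)) (count 1 P))))
    ∈π′ : ∀ y → 1 ≤ y → y ≤ N → 1 ≤ count y π′
    ∈π′ y 1≤y y≤N = ≤-reflexive (sym (once rp′ y 1≤y y≤N))
    C-below-top : ∀ x → x < N → Cπ N ρ x ≡ predIn (0 ∷ ρ) (suc x)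
    C-below-top x x<N = cong (Y ρ) (X-< N x x<N)
    N-1≡m : suc (suc n₂ + suc n₂) ≡ suc m
    N-1≡m = cong suc (sym (+-suc n₂ (suc n₂)))
    C-down : ∀ x → 2 ≤ x → x < N → suc x ≢ a → Cπ N ρ x ≡ pred x
    C-down (suc zero) (s≤s ()) _ _
    C-down (suc (suc x)) _ x<N sx≢a = begin
      Cπ N ρ (2 + x)                ≡⟨ C-below-top (2 + x) x<N ⟩
      predIn (0 ∷ ρ) (3 + x)        ≡⟨ predIn-rotation (3 + x) (∈π′ (3 + x) (s≤s z≤n) x<N) sx≢a ⟩
      cyclicPred π′ (3 + x)         ≡⟨ cyclicPred-π′ (3 + x) ⟩
      cyclicPred π (3 + x)          ≡⟨ cyclicPred-oddsThenEvens-≥3 (suc n₂) (3 + x) (s≤s (s≤s (s≤s z≤n))) x<N ⟩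
      suc x ∎
      where open ≡-Reasoning
    C-one : a ≢ 2 → Cπ N ρ 1 ≡ suc m
    C-one a≢2 = begin
      Cπ N ρ 1                      ≡⟨ C-below-top 1 (≤-trans (s≤s (s≤s z≤n)) (≤-trans 2≤a a≤N)) ⟩
      predIn (0 ∷ ρ) 2              ≡⟨ predIn-rotation 2 (∈π′ 2 (s≤s z≤n) (≤-trans 2≤a a≤N)) (a≢2 ∘ sym) ⟩
      cyclicPred π′ 2               ≡⟨ cyclicPred-π′ 2 ⟩
      cyclicPred π 2                ≡⟨ cyclicPred-oddsThenEvens-2 (suc n₂) ⟩
      suc (suc n₂ + suc n₂)         ≡⟨ N-1≡m ⟩
      suc m ∎
      where open ≡-Reasoning
    C-end : ∀ x → suc x ≡ a → Cπ N ρ x ≡ 0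
    C-end x refl = trans (C-below-top x a≤N) predIn-rotation-head
    C-top : Cπ N ρ N ≡ cyclicPred π a
    C-top = trans (cong (Y ρ) (X-self N)) (trans lastOr-rotation (cyclicPred-π′ a))
    C-top-2 : a ≡ 2 → Cπ N ρ N ≡ suc m
    C-top-2 refl = trans C-top (trans (cyclicPred-oddsThenEvens-2 (suc n₂)) N-1≡m)
    C-top-≥3 : 3 ≤ a → Cπ N ρ N ≡ a ∸ 2
    C-top-≥3 3≤a = trans C-top (cyclicPred-oddsThenEvens-≥3 (suc n₂) a 3≤a a≤N)

  SP-rotation : ∀ p P a Q → (p ∷ P) ++ a ∷ Q ≡ π → length (SP N (a ∷ Q ++ p ∷ P)) ≡ suc m
  SP-rotation p P a Q π′≡π = DescendingCycle.SP-length-maximal m ρ a 2≤a a≤N C-down C-one C-end C-top-2 C-top-≥3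
    where open RotatedOddsThenEvens p P a Q π′≡π

-- Contractions of the rotations

rotate : ℕ → List ℕ → List ℕ
rotate k xs = drop k xs ++ take k xs

rotate-length : ∀ (xs ys : List ℕ) → rotate (length xs) (xs ++ ys) ≡ ys ++ xs
rotate-length xs ys = cong₂ _++_ (drop-length xs) (take-length xs)
  where
  drop-length : ∀ xs → drop (length xs) (xs ++ ys) ≡ ys
  drop-length [] = refl
  drop-length (_ ∷ xs) = drop-length xs
  take-length : ∀ xs → take (length xs) (xs ++ ys) ≡ xs
  take-length [] = refl
  take-length (x ∷ xs) = cong (x ∷_) (take-length xs)

drop-nonempty : ∀ k (xs : List ℕ) → k < length xs → ∃[ a ] ∃[ Q ] drop k xs ≡ a ∷ Q
drop-nonempty zero (x ∷ xs) _ = x , xs , refl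
drop-nonempty (suc k) (x ∷ xs) (s≤s k<len) = drop-nonempty k xs k<len

length-contraction : ∀ n xs → length (contraction n xs) + count (2 * n) xs ≡ length xs
length-contraction n [] = refl
length-contraction n (y ∷ xs) with y ≡ᵇ 2 * n
... | true = trans (+-suc _ _) (cong suc (length-contraction n xs))
... | false = cong suc (length-contraction n xs)

lastOr-∈ : ∀ a Q → 1 ≤ count (lastOr a Q) (a ∷ Q)
lastOr-∈ a [] = count-here-pos a []
lastOr-∈ a (b ∷ Q) = ≤-trans (lastOr-∈ b Q) (count-++ʳ-≤ (lastOr b Q) (a ∷ []) (b ∷ Q))

MaximalContraction : ℕ → ℕ → ℕ → List ℕ → Set
MaximalContraction N n k σ =
  ∃[ π ] (IsPerm N π × length (SP N π) ≡ N ∸ 1 × validContexts N π ≡ k × contraction n π ≡ σ)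

-- M is stated with 2 * n, which does not reduce to n + n.
2*n≡n+n : ∀ n → 2 * n ≡ n + n
2*n≡n+n n = cong (n +_) (+-identityʳ n)

M⇔MaximalContraction : ∀ n σ → M n ((2 * n ∸ 1) C 2) σ ⇔ MaximalContraction (n + n) n ((n + n ∸ 1) C 2) σ
M⇔MaximalContraction n σ = mk⇔ (subst P (2*n≡n+n n)) (subst P (sym (2*n≡n+n n)))
  where
  P : ℕ → Set
  P N = MaximalContraction N n ((N ∸ 1) C 2) σ

module _ (n₂ : ℕ) where

  private
    n : ℕ
    n = 2 + n₂
    m : ℕ
    m = n₂ + suc (suc n₂)
    N : ℕ
    N = n + n
    π : List ℕ
    π = oddsThenEvens n
    rp : IsRangePerm 1 N π
    rp = oddsThenEvens-isRangePerm n

  contractedRotation : ℕ → List ℕ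
  contractedRotation i = contraction n (rotate (suc i) π)

  private
    length-π : length π ≡ N
    length-π = trans (↭-length (stride-interleave-↭ 1 n)) (length-interval 1 N)

    rotation-isRangePerm : ∀ k → IsRangePerm 1 N (rotate k π)
    rotation-isRangePerm k = IsRangePerm-++-comm (take k π) (drop k π) (subst (IsRangePerm 1 N) (sym (take++drop≡id k π)) rp)

    drop-without-1 : ∀ i → count 1 (drop (suc i) π) ≡ 0
    drop-without-1 i = count-++-exclusive 1 (drop (suc i) π) (take (suc i) π)
                         (at-most-once (rotation-isRangePerm (suc i)) 1) (count-here-pos 1 (take i (drop 1 π)))

    drop-with-N : ∀ i → i < suc m → count N (drop (suc i) π) ≡ 1
    drop-with-N i i<m with a , Q , drop≡ ← drop-nonempty (suc i) π (subst (suc i <_) (sym length-π) (s≤s i<m))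
      = ≤-antisym (≤-trans (count-++ʳ-≤ N (take (suc i) π) (drop (suc i) π))
                           (subst (λ l → count N l ≤ 1) (sym (take++drop≡id (suc i) π)) (at-most-once rp N)))
                  (subst (λ l → 1 ≤ count l (drop (suc i) π)) last≡N
                    (subst (λ l → 1 ≤ count (lastOr a Q) l) (sym drop≡) (lastOr-∈ a Q)))
      where
      last≡N : lastOr a Q ≡ N
      last≡N = begin
        lastOr a Q                                   ≡⟨ sym (lastOr-++ 0 (take (suc i) π) (a ∷ Q)) ⟩
        lastOr 0 (take (suc i) π ++ a ∷ Q)           ≡⟨ cong (λ l → lastOr 0 (take (suc i) π ++ l)) (sym drop≡) ⟩
        lastOr 0 (take (suc i) π ++ drop (suc i) π)  ≡⟨ cong (lastOr 0) (take++drop≡id (suc i) π) ⟩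
        lastOr 0 π                                   ≡⟨ lastOr-oddsThenEvens (suc n₂) ⟩
        N ∎
        where open ≡-Reasoning

    length-before-1 : ∀ i → i < suc m → length (contraction n (drop (suc i) π)) + 1 ≡ N ∸ suc i
    length-before-1 i i<m = begin
      length (contraction n (drop (suc i) π)) + 1
        ≡⟨ cong (length (contraction n (drop (suc i) π)) +_) (sym (drop-with-N i i<m)) ⟩
      length (contraction n (drop (suc i) π)) + count N (drop (suc i) π)
        ≡⟨ cong (λ t → length (contraction n (drop (suc i) π)) + count t (drop (suc i) π)) (sym (2*n≡n+n n)) ⟩
      length (contraction n (drop (suc i) π)) + count (2 * n) (drop (suc i) π)
        ≡⟨ length-contraction n (drop (suc i) π) ⟩
      length (drop (suc i) π)
        ≡⟨ trans (length-drop (suc i) π) (cong (_∸ suc i) length-π) ⟩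
      N ∸ suc i ∎
      where open ≡-Reasoning

  -- The contracted rotation by i + 1 is (contracted suffix) 1 (contracted prefix), with 1 absent from the
  -- suffix, whose length N - i - 2 determines i.
  contractedRotation-injective : ∀ {i j} → i < j → j < suc m → contractedRotation i ≢ contractedRotation j
  contractedRotation-injective {i} {j} i<j j<m σᵢ≡σⱼ = <-irrefl i≡j i<j
    where
    split : ∀ k → contractedRotation k ≡ contraction n (drop (suc k) π) ++ 1 ∷ contraction n (take k (drop 1 π))
    split k = filterᵇ-++ (λ x → not (x ≡ᵇ 2 * n)) (drop (suc k) π) (take (suc k) π)
    without-1 : ∀ k → count 1 (contraction n (drop (suc k) π)) ≡ 0
    without-1 k = trans (count-filterᵇ-accept (λ x → not (x ≡ᵇ 2 * n)) 1 (drop (suc k) π) refl) (drop-without-1 k)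
    same-prefix : contraction n (drop (suc i) π) ≡ contraction n (drop (suc j) π)
    same-prefix = proj₁ (first-occurrence-unique 1 _ _ _ _ (trans (sym (split i)) (trans σᵢ≡σⱼ (split j))) (without-1 i) (without-1 j))
    i≡j : i ≡ j
    i≡j = suc-injective (∸-cancelˡ-≡ (s≤s (<⇒≤ (<-trans i<j j<m))) (s≤s (<⇒≤ j<m))
            (trans (sym (length-before-1 i (<-trans i<j j<m))) (trans (cong (λ l → length l + 1) same-prefix) (length-before-1 j j<m))))

  rotation-maximal : ∀ i → i < suc m → MaximalContraction N n ((N ∸ 1) C 2) (contractedRotation i)
  rotation-maximal i i<m with a , Q , drop≡ ← drop-nonempty (suc i) π (subst (suc i <_) (sym length-π) (s≤s i<m)) =
    ρ , Equivalence.from (IsPerm⇔IsRangePerm N ρ) (rotation-isRangePerm (suc i)) , pile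
      , AllInterleave⇒validContexts≡ (rotation-isRangePerm (suc i))
          (rotation-AllInterleave (suc n₂) (take (suc i) π) (drop (suc i) π) (take++drop≡id (suc i) π))
      , refl
    where
    ρ : List ℕ
    ρ = rotate (suc i) π
    pile : length (SP N ρ) ≡ suc m
    pile rewrite drop≡ = SP-rotation n₂ 1 (take i (drop 1 π)) a Q
                           (trans (cong (take (suc i) π ++_) (sym drop≡)) (take++drop≡id (suc i) π))

  maximal⇒rotation : ∀ σ → MaximalContraction N n ((N ∸ 1) C 2) σ → ∃[ i ] (i < suc m × contractedRotation i ≡ σ)
  maximal⇒rotation σ (π′ , isPerm , pile , contexts , refl) =
    from-rotation (rotation-of-oddsThenEvens n₂ π′ rp′ (validContexts≡⇒AllInterleave rp′ contexts))
    where
    rp′ : IsRangePerm 1 N π′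
    rp′ = Equivalence.to (IsPerm⇔IsRangePerm N π′) isPerm
    from-rotation : ∃[ A ] ∃[ B ] (π′ ≡ A ++ 1 ∷ B × (1 ∷ B) ++ A ≡ π) →
                    ∃[ i ] (i < suc m × contractedRotation i ≡ contraction n π′)
    from-rotation ([] , B , π′≡ , rotated) =
      ⊥-elim (0≢1+n (trans (sym (SP-oddsThenEvens n₂)) (trans (cong (λ l → length (SP N l)) π≡π′) pile)))
      where
      π≡π′ : π ≡ π′
      π≡π′ = trans (sym rotated) (trans (++-identityʳ (1 ∷ B)) (sym π′≡))
    from-rotation (a ∷ A′ , B , π′≡ , rotated) = length B , i<m , cong (contraction n) rotated′
      where
      rotated′ : rotate (length (1 ∷ B)) π ≡ π′
      rotated′ = trans (cong (rotate (length (1 ∷ B))) (sym rotated)) (trans (rotate-length (1 ∷ B) (a ∷ A′)) (sym π′≡))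
      i<m : length B < suc m
      i<m = ≤-pred (subst (length (1 ∷ B) <_) (trans (sym (length-++ (1 ∷ B))) (trans (cong length rotated) length-π))
                          (m<m+n (length (1 ∷ B)) z<s))

corollary4p10 : (n : ℕ) → 2 ≤ n →
    ∃[ L ] (Unique L × length L ≡ 2 * n ∸ 1
            × ((σ : List ℕ) → (σ ∈ L) ⇔ M n ((2 * n ∸ 1) C 2) σ))
corollary4p10 (suc (suc n₂)) _ =
  L , applyUpTo⁺₁ (contractedRotation n₂) (n + n ∸ 1) (contractedRotation-injective n₂)
    , trans (length-applyUpTo (contractedRotation n₂) (n + n ∸ 1)) (cong (_∸ 1) (sym (2*n≡n+n n)))
    , λ σ → mk⇔ (from-L σ) (to-L σ)
  where
  n : ℕ
  n = suc (suc n₂)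
  L : List (List ℕ)
  L = applyUpTo (contractedRotation n₂) (n + n ∸ 1)
  from-L : ∀ σ → σ ∈ L → M n ((2 * n ∸ 1) C 2) σ
  from-L σ σ∈L with i , i<m , refl ← ∈-applyUpTo⁻ (contractedRotation n₂) σ∈L =
    Equivalence.from (M⇔MaximalContraction n σ) (rotation-maximal n₂ i i<m)
  to-L : ∀ σ → M n ((2 * n ∸ 1) C 2) σ → σ ∈ L
  to-L σ σ∈M with i , i<m , refl ← maximal⇒rotation n₂ σ (Equivalence.to (M⇔MaximalContraction n σ) σ∈M) =
    ∈-applyUpTo⁺ (contractedRotation n₂) i<m
corollary4p10 (suc zero) (s≤s ())
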